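{- Let $n$ be even and $F\colon\mathbb F_2^n\to\mathbb F_2^n$ a plateaued APN function. Then $$\frac{2^{n+1}-2}{3}\le\mathcal N_F\le 2^{n+1}-2.$$ The lower bound holds with equality if and only if $F$ has $2(2^n-1)/3$ bent component functions and $(2^n-1)/3$ balanced component functions. The upper bound holds with equality if and only if no component function of $F$ is balanced.
   Context: Scalar product $\langle x,y\rangle=\sum x_iy_i$ on $\mathbb F_2^n$; components $F_b(x)=\langle b,F(x)\rangle$, $b\ne0$; $W_F(b,a)=\sum_x(-1)^{F_b(x)+\langle a,x\rangle}$. A Boolean function $f$ is $t$-plateaued if $|W_f(a)|\in\{0,2^{(n+t)/2}\}$ for all $a$, bent if $|W_f(a)|=2^{n/2}$ for all $a$, balanced if it takes value $0$ exactly $2^{n-1}$ times. $F$ is plateaued if each $F_b$, $b\ne0$, is $s_b$-plateaued for some $s_b$. $F$ is APN if for all $a\ne0$ and all $b$ the equation $F(x+a)+F(x)=b$ has at most $2$ solutions. The imbalance is $\mathcal N_F=2^{ -n}\sum_{b\ne0}W_F(b,0)^2$. -}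

module Defs where

open import Data.Bool using (Bool; true; false; _xor_; _∧_)
import Data.Bool as B
open import Data.Nat as ℕ using (ℕ; zero; suc; _^_; _≤_)
open import Data.Nat.Properties using (m^n≢0)
open import Data.Integer as ℤ using (ℤ; +_; ∣_∣)
open import Data.Rational as ℚ using (ℚ)
open import Data.Vec as V using (Vec; []; _∷_; replicate; zipWith)
open import Data.Vec.Properties using (≡-dec)
open import Data.List as L using (List; []; _∷_; _++_; length; filter; map)
open import Data.List.Membership.Propositional using (_∈_)
open import Data.List.Relation.Unary.Unique.Propositional using (Unique)
open import Data.Product using (Σ; _×_)
open import Data.Sum using (_⊎_)
open import Function.Bundles using (_⇔_)
open import Relation.Nullary using (¬_)
open import Relation.Binary.PropositionalEquality using (_≡_; _≢_)

𝔽₂^ : ℕ → Set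
𝔽₂^ n = Vec Bool n

𝟎 : ∀ {n} → 𝔽₂^ n
𝟎 {n} = replicate n false

_⊕_ : ∀ {n} → 𝔽₂^ n → 𝔽₂^ n → 𝔽₂^ n
_⊕_ = zipWith _xor_

⟨_,_⟩ : ∀ {n} → 𝔽₂^ n → 𝔽₂^ n → Bool
⟨ [] , [] ⟩ = false
⟨ x ∷ xs , y ∷ ys ⟩ = (x ∧ y) xor ⟨ xs , ys ⟩

allVec : (n : ℕ) → List (𝔽₂^ n)
allVec zero = [] ∷ []
allVec (suc n) = map (false ∷_) (allVec n) ++ map (true ∷_) (allVec n)

sgn : Bool → ℤ
sgn false = + 1
sgn true = ℤ.- (+ 1)

sumℤ : List ℤ → ℤ
sumℤ = L.foldr ℤ._+_ (+ 0)

walsh : ∀ {n} → (𝔽₂^ n → Bool) → 𝔽₂^ n → ℤ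
walsh {n} f a = sumℤ (map (λ x → sgn (f x xor ⟨ a , x ⟩)) (allVec n))

component : ∀ {n m} → (𝔽₂^ n → 𝔽₂^ m) → 𝔽₂^ m → (𝔽₂^ n → Bool)
component F b x = ⟨ b , F x ⟩

walshF : ∀ {n m} → (𝔽₂^ n → 𝔽₂^ m) → 𝔽₂^ m → 𝔽₂^ n → ℤ
walshF F b a = walsh (component F b) a

-- f is t-plateaued: |W_f(a)| ∈ {0, 2^{(n+t)/2}} for all a
-- (the second alternative written as |W_f(a)|^2 = 2^{n+t}, avoiding half-integer exponents)
Plateaued : ∀ {n} → ℕ → (𝔽₂^ n → Bool) → Set
Plateaued {n} t f = ∀ a → ∣ walsh f a ∣ ≡ 0 ⊎ ∣ walsh f a ∣ ^ 2 ≡ 2 ^ (n ℕ.+ t)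

Bent : ∀ {n} → (𝔽₂^ n → Bool) → Set
Bent {n} f = ∀ a → ∣ walsh f a ∣ ^ 2 ≡ 2 ^ n

Balanced : ∀ {n} → (𝔽₂^ n → Bool) → Set
Balanced {n} f = length (filter (λ x → f x B.≟ false) (allVec n)) ≡ 2 ^ (n ℕ.∸ 1)

PlateauedFn : ∀ {n m} → (𝔽₂^ n → 𝔽₂^ m) → Set
PlateauedFn F = ∀ b → b ≢ 𝟎 → Σ ℕ (λ s → Plateaued s (component F b))

APN : ∀ {n} → (𝔽₂^ n → 𝔽₂^ n) → Set
APN {n} F = ∀ a b → a ≢ 𝟎 →
  length (filter (λ x → ≡-dec B._≟_ (F (x ⊕ a) ⊕ F x) b) (allVec n)) ≤ 2

HasCard : ∀ {n} → (𝔽₂^ n → Set) → ℕ → Set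
HasCard {n} P k = Σ (List (𝔽₂^ n)) λ xs →
  Unique xs × (∀ b → (b ∈ xs) ⇔ P b) × length xs ≡ k

NumComponents : ∀ {n m} → (𝔽₂^ n → 𝔽₂^ m) → ((𝔽₂^ n → Bool) → Set) → ℕ → Set
NumComponents F P k = HasCard (λ b → b ≢ 𝟎 × P (component F b)) k

imbalanceSum : ∀ {n} → (𝔽₂^ n → 𝔽₂^ n) → ℤ
imbalanceSum {n} F =
  sumℤ (map (λ b → walshF F b 𝟎 ℤ.* walshF F b 𝟎)
            (filter (λ b → ¬? (≡-dec B._≟_ b 𝟎)) (allVec n)))
  where open import Relation.Nullary.Decidable using (¬?)

imbalance : ∀ {n} → (𝔽₂^ n → 𝔽₂^ n) → ℚ
imbalance {n} F = ℚ._/_ (imbalanceSum F) (2 ^ n) {{m^n≢0 2 n}}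

module Submission where

-- For b ≠ 0 let s_b be the plateau exponent of the component F_b, so that W_b(a)² ∈ {0, 2^(n+s_b)}.
-- Parseval turns this into Σ_a W_b(a)⁴ = 2^(3n)·2^(s_b), while for an APN function, whose derivatives
-- x ↦ F(x) + F(x + u), u ≠ 0, are two-to-one, Σ_{b≠0} Σ_a W_b(a)⁴ = 2^(3n)·2(2^n − 1).  Hence
-- Σ_{b≠0} 2^(s_b) = 2(2^n − 1).  As W_b(0)² is 0 or 2^(n+s_b), N_F is the sum of 2^(s_b) over the
-- unbalanced components, so N_F ≤ 2(2^n − 1) with equality iff no component is balanced.
-- Since n is even every s_b is even: F_b is either bent (s_b = 0, and not balanced) or 2^(s_b) ≥ 4.
-- In both cases 4 ≤ 3·ν_b + 2^(s_b), where ν_b = W_b(0)²/2^n, and summing over b ≠ 0 gives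
-- 3·N_F ≥ 2(2^n − 1), with equality iff every component is bent, or balanced and 2-plateaued; that
-- fixes the numbers of bent and balanced components.

open import Defs
open import Data.Nat as ℕ using (ℕ; zero; suc)
open import Data.Bool as B using (Bool; true; false; _xor_; _∧_; not; if_then_else_)
open import Data.Vec using ([]; _∷_)
open import Algebra.Bundles using (CommutativeSemiring)
open import Relation.Binary.PropositionalEquality using (_≡_)

module Vector where
  open import Relation.Binary.PropositionalEquality
  open import Data.Bool.Properties
    using (xor-comm; xor-assoc; xor-identityˡ; xor-identityʳ; xor-same; ∧-distribˡ-xor; xor-∧-commutativeRing)
  open import Data.Vec.Properties using (≡-dec; zipWith-comm; zipWith-assoc; zipWith-identityˡ; zipWith-identityʳ)
  open import Relation.Binary.Definitions using (DecidableEquality)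
  open import Relation.Nullary using (does)
  open import Data.Empty using (⊥-elim)
  open import Data.Product using (Σ; _,_)
  open import Algebra.Bundles using (CommutativeRing)
  open import Algebra.Properties.CommutativeSemigroup
    (CommutativeRing.+-commutativeSemigroup xor-∧-commutativeRing) using (interchange)

  infix 4 _≟ᵥ_
  _≟ᵥ_ : ∀ {n} → DecidableEquality (𝔽₂^ n)
  _≟ᵥ_ = ≡-dec B._≟_

  ⊕-comm : ∀ {n} (x y : 𝔽₂^ n) → x ⊕ y ≡ y ⊕ x
  ⊕-comm = zipWith-comm xor-comm

  ⊕-assoc : ∀ {n} (x y z : 𝔽₂^ n) → (x ⊕ y) ⊕ z ≡ x ⊕ (y ⊕ z)
  ⊕-assoc = zipWith-assoc xor-assoc

  ⊕-identityˡ : ∀ {n} (x : 𝔽₂^ n) → 𝟎 ⊕ x ≡ x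
  ⊕-identityˡ = zipWith-identityˡ xor-identityˡ

  ⊕-identityʳ : ∀ {n} (x : 𝔽₂^ n) → x ⊕ 𝟎 ≡ x
  ⊕-identityʳ = zipWith-identityʳ xor-identityʳ

  ⊕-self : ∀ {n} (x : 𝔽₂^ n) → x ⊕ x ≡ 𝟎
  ⊕-self [] = refl
  ⊕-self (a ∷ x) = cong₂ _∷_ (xor-same a) (⊕-self x)

  ⊕-cancelˡ : ∀ {n} (x u : 𝔽₂^ n) → x ⊕ (x ⊕ u) ≡ u
  ⊕-cancelˡ x u = trans (sym (⊕-assoc x x u)) (trans (cong (_⊕ u) (⊕-self x)) (⊕-identityˡ u))

  ⊕-cancelʳ : ∀ {n} (x u : 𝔽₂^ n) → (x ⊕ u) ⊕ u ≡ x
  ⊕-cancelʳ x u = trans (⊕-assoc x u u) (trans (cong (x ⊕_) (⊕-self u)) (⊕-identityʳ x))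

  ⟨⟩-⊕ʳ : ∀ {n} (a x y : 𝔽₂^ n) → ⟨ a , x ⊕ y ⟩ ≡ ⟨ a , x ⟩ xor ⟨ a , y ⟩
  ⟨⟩-⊕ʳ [] [] [] = refl
  ⟨⟩-⊕ʳ (a ∷ as) (x ∷ xs) (y ∷ ys) rewrite ⟨⟩-⊕ʳ as xs ys | ∧-distribˡ-xor a x y =
    interchange (a ∧ x) (a ∧ y) ⟨ as , xs ⟩ ⟨ as , ys ⟩

  ⟨𝟎,⟩ : ∀ {n} (x : 𝔽₂^ n) → ⟨ 𝟎 , x ⟩ ≡ false
  ⟨𝟎,⟩ [] = refl
  ⟨𝟎,⟩ (_ ∷ x) = ⟨𝟎,⟩ x

  nonzero⇒dim≡suc : ∀ {n} {b : 𝔽₂^ n} → b ≢ 𝟎 → Σ ℕ λ m → n ≡ suc m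
  nonzero⇒dim≡suc {b = []} []≢𝟎 = ⊥-elim ([]≢𝟎 refl)
  nonzero⇒dim≡suc {b = _ ∷ _} _ = _ , refl

  ⊕≟𝟎 : ∀ {n} (x y : 𝔽₂^ n) → does (x ⊕ y ≟ᵥ 𝟎) ≡ does (x ≟ᵥ y)
  ⊕≟𝟎 [] [] = refl
  ⊕≟𝟎 (false ∷ x) (false ∷ y) = ⊕≟𝟎 x y
  ⊕≟𝟎 (false ∷ x) (true ∷ y) = refl
  ⊕≟𝟎 (true ∷ x) (false ∷ y) = refl
  ⊕≟𝟎 (true ∷ x) (true ∷ y) = ⊕≟𝟎 x y


module Summation {c ℓ} (R : CommutativeSemiring c ℓ) where
  open CommutativeSemiring R
  open import Relation.Binary.Reasoning.Setoid setoid
  open import Algebra.Properties.CommutativeSemigroup +-commutativeSemigroup using (interchange)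
  open import Data.List using (List; []; _∷_; foldr; map; filter; _++_)
  open import Data.List.Properties using (map-++; map-∘)
  open import Relation.Unary using (Pred; Decidable)
  open import Relation.Binary.PropositionalEquality as ≡ using (_≡_)
  open import Relation.Nullary using (Dec; does; ¬_)
  open import Relation.Nullary.Decidable using (does-⇔; dec-true; dec-false)
  open import Function.Bundles using (_⇔_; mk⇔)
  open Vector using (_≟ᵥ_)

  ∑ : (n : ℕ) → (𝔽₂^ n → Carrier) → Carrier
  ∑ zero f = f []
  ∑ (suc n) f = ∑ n (λ x → f (false ∷ x)) + ∑ n (λ x → f (true ∷ x))

  ∑-cong : ∀ n {f g : 𝔽₂^ n → Carrier} → (∀ x → f x ≈ g x) → ∑ n f ≈ ∑ n g
  ∑-cong zero f≈g = f≈g []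
  ∑-cong (suc n) f≈g = +-cong (∑-cong n (λ x → f≈g (false ∷ x))) (∑-cong n (λ x → f≈g (true ∷ x)))

  ∑-distrib-+ : ∀ n (f g : 𝔽₂^ n → Carrier) → ∑ n (λ x → f x + g x) ≈ ∑ n f + ∑ n g
  ∑-distrib-+ zero f g = refl
  ∑-distrib-+ (suc n) f g = begin
    ∑ n (λ x → f (false ∷ x) + g (false ∷ x)) + ∑ n (λ x → f (true ∷ x) + g (true ∷ x))
      ≈⟨ +-cong (∑-distrib-+ n _ _) (∑-distrib-+ n _ _) ⟩
    (∑ n (λ x → f (false ∷ x)) + ∑ n (λ x → g (false ∷ x)))
      + (∑ n (λ x → f (true ∷ x)) + ∑ n (λ x → g (true ∷ x)))
      ≈⟨ interchange _ _ _ _ ⟩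
    ∑ (suc n) f + ∑ (suc n) g ∎

  ∑-*ˡ : ∀ n a (f : 𝔽₂^ n → Carrier) → ∑ n (λ x → a * f x) ≈ a * ∑ n f
  ∑-*ˡ zero a f = refl
  ∑-*ˡ (suc n) a f = trans (+-cong (∑-*ˡ n a _) (∑-*ˡ n a _)) (sym (distribˡ a _ _))

  ∑-zero : ∀ n (f : 𝔽₂^ n → Carrier) → ∑ n (λ x → 0# * f x) ≈ 0#
  ∑-zero n f = trans (∑-*ˡ n 0# f) (zeroˡ _)

  ∑-*ʳ : ∀ n a (f : 𝔽₂^ n → Carrier) → ∑ n (λ x → f x * a) ≈ ∑ n f * a
  ∑-*ʳ n a f = trans (∑-cong n (λ x → *-comm (f x) a)) (trans (∑-*ˡ n a f) (*-comm a _))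

  ∑-comm : ∀ n m (g : 𝔽₂^ n → 𝔽₂^ m → Carrier) →
    ∑ n (λ x → ∑ m (λ y → g x y)) ≈ ∑ m (λ y → ∑ n (λ x → g x y))
  ∑-comm zero m g = refl
  ∑-comm (suc n) m g = begin
    ∑ n (λ x → ∑ m (g (false ∷ x))) + ∑ n (λ x → ∑ m (g (true ∷ x)))
      ≈⟨ +-cong (∑-comm n m _) (∑-comm n m _) ⟩
    ∑ m (λ y → ∑ n (λ x → g (false ∷ x) y)) + ∑ m (λ y → ∑ n (λ x → g (true ∷ x) y))
      ≈⟨ sym (∑-distrib-+ m _ _) ⟩
    ∑ m (λ y → ∑ (suc n) (λ x → g x y)) ∎

  ∑-*-∑ : ∀ n m (f : 𝔽₂^ n → Carrier) (g : 𝔽₂^ m → Carrier) →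
    ∑ n f * ∑ m g ≈ ∑ n (λ x → ∑ m (λ y → f x * g y))
  ∑-*-∑ n m f g = trans (sym (∑-*ʳ n (∑ m g) f)) (∑-cong n (λ x → sym (∑-*ˡ m (f x) g)))

  ∑-translate : ∀ n (f : 𝔽₂^ n → Carrier) a → ∑ n (λ x → f (x ⊕ a)) ≈ ∑ n f
  ∑-translate zero f [] = refl
  ∑-translate (suc n) f (false ∷ a) = +-cong (∑-translate n _ a) (∑-translate n _ a)
  ∑-translate (suc n) f (true ∷ a) = trans (+-cong (∑-translate n _ a) (∑-translate n _ a)) (+-comm _ _)

  foldr-allVec : ∀ n (f : 𝔽₂^ n → Carrier) → foldr _+_ 0# (map f (allVec n)) ≈ ∑ n f
  foldr-allVec zero f = +-identityʳ (f [])
  foldr-allVec (suc n) f = begin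
    foldr _+_ 0# (map f (map (false ∷_) (allVec n) ++ map (true ∷_) (allVec n)))
      ≡⟨ ≡.cong (foldr _+_ 0#) (map-++ f (map (false ∷_) (allVec n)) _) ⟩
    foldr _+_ 0# (map f (map (false ∷_) (allVec n)) ++ map f (map (true ∷_) (allVec n)))
      ≈⟨ foldr-++ (map f (map (false ∷_) (allVec n))) ⟩
    foldr _+_ 0# (map f (map (false ∷_) (allVec n))) + foldr _+_ 0# (map f (map (true ∷_) (allVec n)))
      ≡⟨ ≡.sym (≡.cong₂ (λ xs ys → foldr _+_ 0# xs + foldr _+_ 0# ys) (map-∘ (allVec n)) (map-∘ (allVec n))) ⟩
    foldr _+_ 0# (map (λ x → f (false ∷ x)) (allVec n)) + foldr _+_ 0# (map (λ x → f (true ∷ x)) (allVec n))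
      ≈⟨ +-cong (foldr-allVec n _) (foldr-allVec n _) ⟩
    ∑ (suc n) f ∎
    where
    foldr-++ : ∀ (xs : List Carrier) {ys} → foldr _+_ 0# (xs ++ ys) ≈ foldr _+_ 0# xs + foldr _+_ 0# ys
    foldr-++ [] = sym (+-identityˡ _)
    foldr-++ (x ∷ xs) = trans (+-congˡ (foldr-++ xs)) (sym (+-assoc x _ _))

  𝟙 : ∀ {p} {P : Set p} → Dec P → Carrier
  𝟙 P? = if does P? then 1# else 0#

  𝟙-⇔ : ∀ {p q} {P : Set p} {Q : Set q} → P ⇔ Q → (P? : Dec P) (Q? : Dec Q) → 𝟙 P? ≡ 𝟙 Q?
  𝟙-⇔ P⇔Q P? Q? = ≡.cong (if_then 1# else 0#) (does-⇔ P⇔Q P? Q?)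

  𝟙-yes : ∀ {p} {P : Set p} (P? : Dec P) → P → 𝟙 P? ≡ 1#
  𝟙-yes P? p = ≡.cong (if_then 1# else 0#) (dec-true P? p)

  𝟙-no : ∀ {p} {P : Set p} (P? : Dec P) → ¬ P → 𝟙 P? ≡ 0#
  𝟙-no P? ¬p = ≡.cong (if_then 1# else 0#) (dec-false P? ¬p)

  δ : ∀ {n} → 𝔽₂^ n → 𝔽₂^ n → Carrier
  δ x y = 𝟙 (x ≟ᵥ y)

  δ-sym : ∀ {n} (x y : 𝔽₂^ n) → δ x y ≡ δ y x
  δ-sym x y = 𝟙-⇔ (mk⇔ ≡.sym ≡.sym) (x ≟ᵥ y) (y ≟ᵥ x)

  foldr-filter : ∀ {a p} {A : Set a} {P : Pred A p} (P? : Decidable P) (g : A → Carrier) xs →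
    foldr _+_ 0# (map g (filter P? xs)) ≈ foldr _+_ 0# (map (λ x → 𝟙 (P? x) * g x) xs)
  foldr-filter P? g [] = refl
  foldr-filter P? g (x ∷ xs) with does (P? x)
  ... | true = +-cong (sym (*-identityˡ (g x))) (foldr-filter P? g xs)
  ... | false = trans (foldr-filter P? g xs) (sym (trans (+-congʳ (zeroˡ (g x))) (+-identityˡ _)))

  ∑-δ : ∀ n x (g : 𝔽₂^ n → Carrier) → ∑ n (λ y → δ y x * g y) ≈ g x
  ∑-δ zero [] g = *-identityˡ (g [])
  ∑-δ (suc n) (false ∷ x) g = trans (+-cong (∑-δ n x _) (∑-zero n _)) (+-identityʳ _)
  ∑-δ (suc n) (true ∷ x) g = trans (+-cong (∑-zero n _) (∑-δ n x _)) (+-identityˡ _)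

  ∑-δ₁ : ∀ n (x : 𝔽₂^ n) → ∑ n (λ y → δ y x) ≈ 1#
  ∑-δ₁ n x = trans (∑-cong n (λ y → sym (*-identityʳ (δ y x)))) (∑-δ n x (λ _ → 1#))

module ℕSum where
  open import Level using (0ℓ)
  open import Data.Nat using (_+_; _*_; _^_; _∸_; _≤_)
  open import Data.Nat.Properties
  open import Data.List using (List; []; _∷_; length; filter; map; _++_)
  open import Data.Nat.ListAction using (sum)
  open import Data.List.Membership.Propositional using (_∈_; _∉_)
  open import Data.List.Membership.Propositional.Properties
    using (∈-++⁺ˡ; ∈-++⁺ʳ; ∈-map⁺; ∈-map⁻; ∈-filter⁺; ∈-filter⁻)
  open import Data.List.Relation.Unary.Any using (here)
  import Data.List.Relation.Unary.All as All
  open import Data.List.Relation.Unary.AllPairs using ([]; _∷_)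
  open import Data.List.Relation.Unary.Unique.Propositional using (Unique)
  import Data.List.Relation.Unary.Unique.Propositional.Properties as Unique
  open import Data.Product using (_×_; _,_; proj₁; proj₂)
  open import Data.Vec.Properties using (∷-injectiveʳ)
  open import Function.Bundles using (_⇔_; mk⇔)
  open import Relation.Binary.PropositionalEquality
  open import Relation.Nullary using (does; yes; no; ¬_; ¬?)
  open import Relation.Nullary.Decidable using (dec-false)
  open import Relation.Unary using (Pred; Decidable)
  open Vector using (_≟ᵥ_)
  import Data.List.Membership.DecPropositional as DecMembership
  open Summation +-*-commutativeSemiring public

  ∑-const : ∀ n c → ∑ n (λ _ → c) ≡ 2 ^ n * c
  ∑-const zero c = sym (+-identityʳ c)
  ∑-const (suc n) c rewrite ∑-const n c =
    trans (sym (*-distribʳ-+ c (2 ^ n) (2 ^ n))) (cong (λ m → (2 ^ n + m) * c) (sym (+-identityʳ (2 ^ n))))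

  ∑-mono-≤ : ∀ n {f g : 𝔽₂^ n → ℕ} → (∀ x → f x ≤ g x) → ∑ n f ≤ ∑ n g
  ∑-mono-≤ zero f≤g = f≤g []
  ∑-mono-≤ (suc n) f≤g =
    +-mono-≤ (∑-mono-≤ n (λ x → f≤g (false ∷ x))) (∑-mono-≤ n (λ x → f≤g (true ∷ x)))

  +-≡⇒≡ : ∀ {a b c d} → a ≤ c → b ≤ d → a + b ≡ c + d → a ≡ c × b ≡ d
  +-≡⇒≡ {a} {b} {c} {d} a≤c b≤d eq = a≡c , +-cancelˡ-≡ a b d (trans eq (cong (_+ d) (sym a≡c)))
    where a≡c = ≤-antisym a≤c (+-cancelʳ-≤ d c a (subst (_≤ a + d) eq (+-monoʳ-≤ a b≤d)))

  ∑-≡⇒≗ : ∀ n {f g : 𝔽₂^ n → ℕ} → (∀ x → f x ≤ g x) → ∑ n f ≡ ∑ n g → ∀ x → f x ≡ g x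
  ∑-≡⇒≗ zero f≤g eq [] = eq
  ∑-≡⇒≗ (suc n) {f} {g} f≤g eq (b ∷ x) = ∑-≡⇒≗ n (λ x → f≤g (b ∷ x)) (half b) x
    where
    halves = +-≡⇒≡ (∑-mono-≤ n (λ x → f≤g (false ∷ x))) (∑-mono-≤ n (λ x → f≤g (true ∷ x))) eq
    half : ∀ b → ∑ n (λ x → f (b ∷ x)) ≡ ∑ n (λ x → g (b ∷ x))
    half false = proj₁ halves
    half true = proj₂ halves

  ∑-nonzero : ∀ n → ∑ n (λ b → 𝟙 (¬? (b ≟ᵥ 𝟎))) ≡ 2 ^ n ∸ 1
  ∑-nonzero zero = refl
  ∑-nonzero (suc n) rewrite ∑-nonzero n | ∑-const n 1 | *-identityʳ (2 ^ n) =
    trans (sym (+-∸-comm (2 ^ n) (m^n>0 2 n))) (cong (λ m → 2 ^ n + m ∸ 1) (sym (+-identityʳ (2 ^ n))))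

  length-filter-allVec : ∀ n {P : Pred (𝔽₂^ n) 0ℓ} (P? : Decidable P) →
    length (filter P? (allVec n)) ≡ ∑ n (λ x → 𝟙 (P? x))
  length-filter-allVec n P? = trans (length-filter (allVec n)) (foldr-allVec n _)
    where
    length-filter : ∀ xs → length (filter P? xs) ≡ sum (map (λ x → 𝟙 (P? x)) xs)
    length-filter [] = refl
    length-filter (x ∷ xs) with does (P? x)
    ... | true = cong suc (length-filter xs)
    ... | false = length-filter xs

  allVec-complete : ∀ n (x : 𝔽₂^ n) → x ∈ allVec n
  allVec-complete zero [] = here refl
  allVec-complete (suc n) (false ∷ x) = ∈-++⁺ˡ (∈-map⁺ (false ∷_) (allVec-complete n x))
  allVec-complete (suc n) (true ∷ x) =
    ∈-++⁺ʳ (map (false ∷_) (allVec n)) (∈-map⁺ (true ∷_) (allVec-complete n x))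

  allVec-unique : ∀ n → Unique (allVec n)
  allVec-unique zero = All.[] ∷ []
  allVec-unique (suc n) =
    Unique.++⁺ (Unique.map⁺ ∷-injectiveʳ (allVec-unique n)) (Unique.map⁺ ∷-injectiveʳ (allVec-unique n)) disjoint
    where
    disjoint : ∀ {v} → ¬ (v ∈ map (false ∷_) (allVec n) × v ∈ map (true ∷_) (allVec n))
    disjoint (v∈₁ , v∈₂) with ∈-map⁻ (false ∷_) v∈₁ | ∈-map⁻ (true ∷_) v∈₂
    ... | _ , _ , refl | _ , _ , ()

  length-unique : ∀ n (xs : List (𝔽₂^ n)) → Unique xs →
    length xs ≡ ∑ n (λ b → 𝟙 (DecMembership._∈?_ _≟ᵥ_ b xs))
  length-unique n [] _ = sym (trans (∑-const n 0) (*-zeroʳ (2 ^ n)))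
  length-unique n (y ∷ ys) (y∉ys ∷ unique) = begin
    suc (length ys)                                   ≡⟨ cong₂ _+_ (sym (∑-δ₁ n y)) (length-unique n ys unique) ⟩
    ∑ n (λ b → δ b y) + ∑ n (λ b → 𝟙 (b ∈? ys))      ≡⟨ sym (∑-distrib-+ n _ _) ⟩
    ∑ n (λ b → δ b y + 𝟙 (b ∈? ys))                  ≡⟨ ∑-cong n indicator-∷ ⟩
    ∑ n (λ b → 𝟙 (b ∈? (y ∷ ys)))                    ∎
    where
    open ≡-Reasoning
    open DecMembership _≟ᵥ_ using (_∈?_)
    indicator-∷ : ∀ b → δ b y + 𝟙 (b ∈? ys) ≡ 𝟙 (b ∈? (y ∷ ys))
    indicator-∷ b with b ≟ᵥ y
    ... | no _ = refl
    ... | yes refl rewrite dec-false (b ∈? ys) (λ b∈ys → All.lookup y∉ys b∈ys refl) = refl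

  hasCard⇔ : ∀ n {P : Pred (𝔽₂^ n) 0ℓ} (P? : Decidable P) k → HasCard P k ⇔ (k ≡ ∑ n (λ b → 𝟙 (P? b)))
  hasCard⇔ n {P} P? k = mk⇔ to from
    where
    open DecMembership _≟ᵥ_ using (_∈?_)
    to : HasCard P k → k ≡ ∑ n (λ b → 𝟙 (P? b))
    to (xs , unique , xs⇔P , refl) =
      trans (length-unique n xs unique) (∑-cong n (λ b → 𝟙-⇔ (xs⇔P b) (b ∈? xs) (P? b)))
    from : k ≡ ∑ n (λ b → 𝟙 (P? b)) → HasCard P k
    from refl = filter P? (allVec n) , Unique.filter⁺ P? (allVec-unique n) , filter⇔P , length-filter-allVec n P?
      where
      filter⇔P : ∀ b → b ∈ filter P? (allVec n) ⇔ P b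
      filter⇔P b = mk⇔ (λ b∈ → proj₂ (∈-filter⁻ P? {xs = allVec n} b∈)) (∈-filter⁺ P? (allVec-complete n b))

module ℤSum where
  open import Data.Nat using (_^_)
  import Data.Nat.Properties as ℕP
  open import Data.Integer using (ℤ; +_; -_; _+_; _*_; -1ℤ)
  open import Data.Integer.Properties
  open import Data.Product using (∃; _,_)
  open import Relation.Binary.PropositionalEquality
  open import Relation.Nullary using (Dec; does; yes; no; ¬?)
  open Vector
  open Summation +-*-commutativeSemiring public

  2^[1+n]* : ∀ n c → + 2 ^ suc n * c ≡ + 2 ^ n * c + + 2 ^ n * c
  2^[1+n]* n c = trans (cong (λ m → + (2 ^ n ℕ.+ m) * c) (ℕP.+-identityʳ (2 ^ n)))
    (trans (cong (_* c) (pos-+ (2 ^ n) (2 ^ n))) (*-distribʳ-+ c (+ 2 ^ n) (+ 2 ^ n)))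

  ∑-const : ∀ n c → ∑ n (λ _ → c) ≡ + 2 ^ n * c
  ∑-const zero c = sym (*-identityˡ c)
  ∑-const (suc n) c = trans (cong₂ _+_ (∑-const n c) (∑-const n c)) (sym (2^[1+n]* n c))

  ∑-neg : ∀ n (f : 𝔽₂^ n → ℤ) → ∑ n (λ x → - f x) ≡ - ∑ n f
  ∑-neg n f = trans (∑-cong n (λ x → sym (-1*i≡-i (f x)))) (trans (∑-*ˡ n -1ℤ f) (-1*i≡-i _))

  ∑-pos : ∀ n (f : 𝔽₂^ n → ℕ) → ∑ n (λ x → + f x) ≡ + ℕSum.∑ n f
  ∑-pos zero f = refl
  ∑-pos (suc n) f = trans (cong₂ _+_ (∑-pos n _) (∑-pos n _)) (sym (pos-+ (ℕSum.∑ n _) _))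

  ∑≢0⇒∃≢0 : ∀ n (f : 𝔽₂^ n → ℤ) → ∑ n f ≢ + 0 → ∃ λ x → f x ≢ + 0
  ∑≢0⇒∃≢0 zero f ∑≢0 = [] , ∑≢0
  ∑≢0⇒∃≢0 (suc n) f ∑≢0 with ∑ n (λ x → f (false ∷ x)) ≟ + 0
  ... | no ∑₀≢0 with ∑≢0⇒∃≢0 n _ ∑₀≢0
  ...   | x , fx≢0 = false ∷ x , fx≢0
  ∑≢0⇒∃≢0 (suc n) f ∑≢0 | yes ∑₀≡0
    with ∑≢0⇒∃≢0 n (λ x → f (true ∷ x)) (λ ∑₁≡0 → ∑≢0 (cong₂ _+_ ∑₀≡0 ∑₁≡0))
  ...   | x , fx≢0 = true ∷ x , fx≢0

  𝟙-pos : ∀ {p} {P : Set p} (P? : Dec P) → + ℕSum.𝟙 P? ≡ 𝟙 P?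
  𝟙-pos P? with does P?
  ... | false = refl
  ... | true = refl

  ∑-nonzero : ∀ {n} → ∑ n (λ b → 𝟙 (¬? (b ≟ᵥ 𝟎))) ≡ + (2 ^ n ℕ.∸ 1)
  ∑-nonzero {n} =
    trans (sym (∑-cong n (λ b → 𝟙-pos (¬? (b ≟ᵥ 𝟎))))) (trans (∑-pos n _) (cong +_ (ℕSum.∑-nonzero n)))

  ∑-split-𝟎 : ∀ n (g : 𝔽₂^ n → ℤ) → ∑ n g ≡ g 𝟎 + ∑ n (λ b → 𝟙 (¬? (b ≟ᵥ 𝟎)) * g b)
  ∑-split-𝟎 n g = begin
    ∑ n g                                    ≡⟨ ∑-cong n (λ b → split (does (b ≟ᵥ 𝟎)) (g b)) ⟩
    ∑ n (λ b → δ b 𝟎 * g b + restricted b)   ≡⟨ ∑-distrib-+ n _ _ ⟩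
    ∑ n (λ b → δ b 𝟎 * g b) + ∑ n restricted ≡⟨ cong (_+ ∑ n restricted) (∑-δ n 𝟎 g) ⟩
    g 𝟎 + ∑ n restricted                     ∎
    where
    open ≡-Reasoning
    restricted = λ b → 𝟙 (¬? (b ≟ᵥ 𝟎)) * g b
    split : ∀ c z → z ≡ (if c then + 1 else + 0) * z + (if not c then + 1 else + 0) * z
    split false z = sym (trans (+-identityˡ _) (*-identityˡ z))
    split true z = sym (trans (+-identityʳ _) (*-identityˡ z))

module Fourier where
  open import Data.Nat using (_^_)
  open import Data.Integer using (ℤ; +_; -_; _+_; _-_; _*_)
  open import Data.Integer.Properties
  open import Data.Integer.Tactic.RingSolver using (solve-∀)
  open import Function.Base using (_∘_)
  open import Relation.Binary.PropositionalEquality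
  open Vector
  open ℤSum

  sgn-xor : ∀ p q → sgn (p xor q) ≡ sgn p * sgn q
  sgn-xor false q = sym (*-identityˡ (sgn q))
  sgn-xor true false = refl
  sgn-xor true true = refl

  sgn-² : ∀ p → sgn p * sgn p ≡ + 1
  sgn-² false = refl
  sgn-² true = refl

  sgn-not : ∀ p → sgn (not p) ≡ - sgn p
  sgn-not false = refl
  sgn-not true = refl

  character-⊕ : ∀ {n} (a x y : 𝔽₂^ n) → sgn ⟨ a , x ⊕ y ⟩ ≡ sgn ⟨ a , x ⟩ * sgn ⟨ a , y ⟩
  character-⊕ a x y = trans (cong sgn (⟨⟩-⊕ʳ a x y)) (sgn-xor ⟨ a , x ⟩ ⟨ a , y ⟩)

  orthogonality : ∀ n (v : 𝔽₂^ n) → ∑ n (λ a → sgn ⟨ a , v ⟩) ≡ + 2 ^ n * δ v 𝟎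
  orthogonality zero [] = refl
  orthogonality (suc n) (false ∷ v) =
    trans (cong₂ _+_ (orthogonality n v) (orthogonality n v)) (sym (2^[1+n]* n (δ v 𝟎)))
  orthogonality (suc n) (true ∷ v) = begin
    ∑ n (λ a → sgn ⟨ a , v ⟩) + ∑ n (λ a → sgn (not ⟨ a , v ⟩))
      ≡⟨ cong (_+_ (∑ n (λ a → sgn ⟨ a , v ⟩))) (trans (∑-cong n (λ a → sgn-not ⟨ a , v ⟩)) (∑-neg n _)) ⟩
    ∑ n (λ a → sgn ⟨ a , v ⟩) - ∑ n (λ a → sgn ⟨ a , v ⟩)
      ≡⟨ +-inverseʳ (∑ n (λ a → sgn ⟨ a , v ⟩)) ⟩
    + 0
      ≡⟨ sym (*-zeroʳ (+ 2 ^ suc n)) ⟩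
    + 2 ^ suc n * + 0 ∎
    where open ≡-Reasoning

  ∑-character-product : ∀ n (x y : 𝔽₂^ n) → ∑ n (λ a → sgn ⟨ a , x ⟩ * sgn ⟨ a , y ⟩) ≡ + 2 ^ n * δ x y
  ∑-character-product n x y = begin
    ∑ n (λ a → sgn ⟨ a , x ⟩ * sgn ⟨ a , y ⟩) ≡⟨ ∑-cong n (λ a → sym (character-⊕ a x y)) ⟩
    ∑ n (λ a → sgn ⟨ a , x ⊕ y ⟩)             ≡⟨ orthogonality n (x ⊕ y) ⟩
    + 2 ^ n * δ (x ⊕ y) 𝟎                     ≡⟨ cong (λ c → + 2 ^ n * (if c then + 1 else + 0)) (⊕≟𝟎 x y) ⟩
    + 2 ^ n * δ x y                           ∎
    where open ≡-Reasoning

  plancherel : ∀ n m (h k : 𝔽₂^ m → ℤ) (φ ψ : 𝔽₂^ m → 𝔽₂^ n) →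
    ∑ n (λ a → ∑ m (λ x → h x * sgn ⟨ a , φ x ⟩) * ∑ m (λ y → k y * sgn ⟨ a , ψ y ⟩))
      ≡ + 2 ^ n * ∑ m (λ x → ∑ m (λ y → h x * k y * δ (φ x) (ψ y)))
  plancherel n m h k φ ψ = begin
    ∑ n (λ a → ∑ m (ĥ a) * ∑ m (k̂ a))                  ≡⟨ ∑-cong n (λ a → ∑-*-∑ m m (ĥ a) (k̂ a)) ⟩
    ∑ n (λ a → ∑ m (λ x → ∑ m (λ y → ĥ a x * k̂ a y)))  ≡⟨ trans (∑-comm n m _) (∑-cong m (λ x → ∑-comm n m _)) ⟩
    ∑ m (λ x → ∑ m (λ y → ∑ n (λ a → ĥ a x * k̂ a y)))  ≡⟨ ∑-cong m (λ x → ∑-cong m (λ y → ∑-over-a x y)) ⟩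
    ∑ m (λ x → ∑ m (λ y → + 2 ^ n * weight x y))        ≡⟨ ∑-cong m (λ x → ∑-*ˡ m (+ 2 ^ n) (weight x)) ⟩
    ∑ m (λ x → + 2 ^ n * ∑ m (weight x))                ≡⟨ ∑-*ˡ m (+ 2 ^ n) _ ⟩
    + 2 ^ n * ∑ m (λ x → ∑ m (weight x))                ∎
    where
    open ≡-Reasoning
    ĥ k̂ : 𝔽₂^ n → 𝔽₂^ m → ℤ
    ĥ a x = h x * sgn ⟨ a , φ x ⟩
    k̂ a y = k y * sgn ⟨ a , ψ y ⟩
    weight : 𝔽₂^ m → 𝔽₂^ m → ℤ
    weight x y = h x * k y * δ (φ x) (ψ y)
    interchange : ∀ p q r s → (p * r) * (q * s) ≡ p * q * (r * s)
    interchange = solve-∀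
    rearrange : ∀ p q r → p * (q * r) ≡ q * (p * r)
    rearrange = solve-∀
    ∑-over-a : ∀ x y → ∑ n (λ a → ĥ a x * k̂ a y) ≡ + 2 ^ n * weight x y
    ∑-over-a x y = begin
      ∑ n (λ a → ĥ a x * k̂ a y)                                   ≡⟨ ∑-cong n (λ a → interchange (h x) (k y) _ _) ⟩
      ∑ n (λ a → h x * k y * (sgn ⟨ a , φ x ⟩ * sgn ⟨ a , ψ y ⟩)) ≡⟨ ∑-*ˡ n (h x * k y) _ ⟩
      h x * k y * ∑ n (λ a → sgn ⟨ a , φ x ⟩ * sgn ⟨ a , ψ y ⟩)   ≡⟨ cong (h x * k y *_) (∑-character-product n (φ x) (ψ y)) ⟩
      h x * k y * (+ 2 ^ n * δ (φ x) (ψ y))                       ≡⟨ rearrange (h x * k y) (+ 2 ^ n) (δ (φ x) (ψ y)) ⟩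
      + 2 ^ n * weight x y                                        ∎

  ∑-collapse : ∀ n (h k : 𝔽₂^ n → ℤ) x → ∑ n (λ y → h x * k y * δ x y) ≡ h x * k x
  ∑-collapse n h k x = trans (∑-cong n (λ y → trans (*-comm _ (δ x y)) (cong (_* (h x * k y)) (δ-sym x y))))
                             (∑-δ n x (λ y → h x * k y))

  walsh-∑ : ∀ {n} (f : 𝔽₂^ n → Bool) a → walsh f a ≡ ∑ n (λ x → sgn (f x) * sgn ⟨ a , x ⟩)
  walsh-∑ {n} f a = trans (foldr-allVec n _) (∑-cong n (λ x → sgn-xor (f x) ⟨ a , x ⟩))

  parseval : ∀ {n} (f : 𝔽₂^ n → Bool) → ∑ n (λ a → walsh f a * walsh f a) ≡ + 2 ^ n * + 2 ^ n
  parseval {n} f = begin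
    ∑ n (λ a → walsh f a * walsh f a)
      ≡⟨ ∑-cong n (λ a → cong₂ _*_ (walsh-∑ f a) (walsh-∑ f a)) ⟩
    ∑ n (λ a → ∑ n (λ x → sgn (f x) * sgn ⟨ a , x ⟩) * ∑ n (λ y → sgn (f y) * sgn ⟨ a , y ⟩))
      ≡⟨ plancherel n n (λ x → sgn (f x)) (λ y → sgn (f y)) (λ x → x) (λ y → y) ⟩
    + 2 ^ n * ∑ n (λ x → ∑ n (λ y → sgn (f x) * sgn (f y) * δ x y))
      ≡⟨ cong (+ 2 ^ n *_) (∑-cong n (λ x → trans (∑-collapse n (sgn ∘ f) (sgn ∘ f) x) (sgn-² (f x)))) ⟩
    + 2 ^ n * ∑ n (λ _ → + 1)
      ≡⟨ cong (+ 2 ^ n *_) (trans (∑-const n (+ 1)) (*-identityʳ _)) ⟩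
    + 2 ^ n * + 2 ^ n ∎
    where open ≡-Reasoning

  autocorrelation : ∀ {n} → (𝔽₂^ n → Bool) → 𝔽₂^ n → ℤ
  autocorrelation {n} f u = ∑ n (λ x → sgn (f x xor f (x ⊕ u)))

  walsh²-autocorrelation : ∀ {n} (f : 𝔽₂^ n → Bool) a →
    walsh f a * walsh f a ≡ ∑ n (λ u → autocorrelation f u * sgn ⟨ a , u ⟩)
  walsh²-autocorrelation {n} f a = begin
    walsh f a * walsh f a
      ≡⟨ cong₂ _*_ (walsh-∑ f a) (walsh-∑ f a) ⟩
    ∑ n (λ x → ŵ x) * ∑ n (λ y → ŵ y)
      ≡⟨ ∑-*-∑ n n ŵ ŵ ⟩
    ∑ n (λ x → ∑ n (λ y → ŵ x * ŵ y))
      ≡⟨ ∑-cong n (λ x → sym (trans (∑-cong n (λ u → cong (λ y → ŵ x * ŵ y) (⊕-comm x u)))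
                                    (∑-translate n (λ y → ŵ x * ŵ y) x))) ⟩
    ∑ n (λ x → ∑ n (λ u → ŵ x * ŵ (x ⊕ u)))
      ≡⟨ ∑-cong n (λ x → ∑-cong n (λ u → cancel-character x u)) ⟩
    ∑ n (λ x → ∑ n (λ u → sgn (f x xor f (x ⊕ u)) * sgn ⟨ a , u ⟩))
      ≡⟨ ∑-comm n n _ ⟩
    ∑ n (λ u → ∑ n (λ x → sgn (f x xor f (x ⊕ u)) * sgn ⟨ a , u ⟩))
      ≡⟨ ∑-cong n (λ u → ∑-*ʳ n _ _) ⟩
    ∑ n (λ u → autocorrelation f u * sgn ⟨ a , u ⟩) ∎
    where
    open ≡-Reasoning
    ŵ : 𝔽₂^ n → ℤ
    ŵ x = sgn (f x) * sgn ⟨ a , x ⟩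
    regroup : ∀ p q r s → r * r ≡ + 1 → (p * r) * (q * (r * s)) ≡ (p * q) * s
    regroup p q r s r²≡1 = trans (solve-∀' p q r s) (trans (cong (_* (p * q * s)) r²≡1) (*-identityˡ _))
      where solve-∀' : ∀ p q r s → (p * r) * (q * (r * s)) ≡ (r * r) * (p * q * s)
            solve-∀' = solve-∀
    cancel-character : ∀ x u → ŵ x * ŵ (x ⊕ u) ≡ sgn (f x xor f (x ⊕ u)) * sgn ⟨ a , u ⟩
    cancel-character x u = begin
      ŵ x * ŵ (x ⊕ u)
        ≡⟨ cong (λ c → ŵ x * (sgn (f (x ⊕ u)) * c)) (character-⊕ a x u) ⟩
      (sgn (f x) * sgn ⟨ a , x ⟩) * (sgn (f (x ⊕ u)) * (sgn ⟨ a , x ⟩ * sgn ⟨ a , u ⟩))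
        ≡⟨ regroup (sgn (f x)) (sgn (f (x ⊕ u))) (sgn ⟨ a , x ⟩) (sgn ⟨ a , u ⟩) (sgn-² ⟨ a , x ⟩) ⟩
      sgn (f x) * sgn (f (x ⊕ u)) * sgn ⟨ a , u ⟩
        ≡⟨ cong (_* sgn ⟨ a , u ⟩) (sym (sgn-xor (f x) (f (x ⊕ u)))) ⟩
      sgn (f x xor f (x ⊕ u)) * sgn ⟨ a , u ⟩ ∎

  fourth-moment : ∀ {n} (f : 𝔽₂^ n → Bool) →
    ∑ n (λ a → (walsh f a * walsh f a) * (walsh f a * walsh f a))
      ≡ + 2 ^ n * ∑ n (λ u → autocorrelation f u * autocorrelation f u)
  fourth-moment {n} f = begin
    ∑ n (λ a → (walsh f a * walsh f a) * (walsh f a * walsh f a))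
      ≡⟨ ∑-cong n (λ a → cong₂ _*_ (walsh²-autocorrelation f a) (walsh²-autocorrelation f a)) ⟩
    ∑ n (λ a → ∑ n (λ u → autocorrelation f u * sgn ⟨ a , u ⟩) * ∑ n (λ v → autocorrelation f v * sgn ⟨ a , v ⟩))
      ≡⟨ plancherel n n (autocorrelation f) (autocorrelation f) (λ u → u) (λ v → v) ⟩
    + 2 ^ n * ∑ n (λ u → ∑ n (λ v → autocorrelation f u * autocorrelation f v * δ u v))
      ≡⟨ cong (+ 2 ^ n *_) (∑-cong n (∑-collapse n (autocorrelation f) (autocorrelation f))) ⟩
    + 2 ^ n * ∑ n (λ u → autocorrelation f u * autocorrelation f u) ∎
    where open ≡-Reasoning

module APNMoment {n : ℕ} (F : 𝔽₂^ n → 𝔽₂^ n) where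
  open import Data.Nat as ℕ using (_^_; _∸_; _≤_)
  import Data.Nat.Properties as ℕP
  open import Data.Integer using (ℤ; +_; _+_; _-_; _*_)
  open import Data.Integer.Properties
  open import Data.Integer.Tactic.RingSolver using (solve-∀)
  open import Data.Empty using (⊥-elim)
  open import Function.Bundles using (_⇔_; mk⇔)
  open import Relation.Binary.PropositionalEquality
  open import Relation.Nullary using (yes; no; ¬?)
  open Vector
  open ℤSum
  open Fourier

  A : ℤ
  A = + 2 ^ n

  derivative : 𝔽₂^ n → 𝔽₂^ n → 𝔽₂^ n
  derivative u x = F x ⊕ F (x ⊕ u)

  derivative-shift : ∀ {u} x → derivative u (x ⊕ u) ≡ derivative u x
  derivative-shift {u} x = trans (cong (λ y → F (x ⊕ u) ⊕ F y) (⊕-cancelʳ x u)) (⊕-comm _ _)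

  collisions : 𝔽₂^ n → ℤ
  collisions u = ∑ n (λ x → ∑ n (λ z → δ (derivative u x) (derivative u z)))

  ∑-autocorrelation² : ∀ u →
    ∑ n (λ b → autocorrelation (component F b) u * autocorrelation (component F b) u) ≡ A * collisions u
  ∑-autocorrelation² u = begin
    ∑ n (λ b → autocorrelation (component F b) u * autocorrelation (component F b) u)
      ≡⟨ ∑-cong n (λ b → cong₂ _*_ (as-character b) (as-character b)) ⟩
    ∑ n (λ b → ∑ n (λ x → + 1 * sgn ⟨ b , derivative u x ⟩) * ∑ n (λ z → + 1 * sgn ⟨ b , derivative u z ⟩))
      ≡⟨ plancherel n n (λ _ → + 1) (λ _ → + 1) (derivative u) (derivative u) ⟩
    A * ∑ n (λ x → ∑ n (λ z → + 1 * δ (derivative u x) (derivative u z)))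
      ≡⟨ cong (A *_) (∑-cong n (λ x → ∑-cong n (λ z → *-identityˡ _))) ⟩
    A * collisions u ∎
    where
    open ≡-Reasoning
    as-character : ∀ b → autocorrelation (component F b) u ≡ ∑ n (λ x → + 1 * sgn ⟨ b , derivative u x ⟩)
    as-character b = ∑-cong n (λ x → trans (cong sgn (sym (⟨⟩-⊕ʳ b (F x) (F (x ⊕ u))))) (sym (*-identityˡ _)))

  collisions-𝟎 : collisions 𝟎 ≡ A * A
  collisions-𝟎 = begin
    collisions 𝟎                       ≡⟨ ∑-cong n (λ x → ∑-cong n (λ z → cong₂ δ (derivative-𝟎 x) (derivative-𝟎 z))) ⟩
    ∑ n (λ x → ∑ n (λ z → δ {n} 𝟎 𝟎))  ≡⟨ trans (∑-cong n (λ x → ∑-const n (δ {n} 𝟎 𝟎))) (∑-const n _) ⟩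
    A * (A * δ {n} 𝟎 𝟎)                ≡⟨ cong (λ d → A * (A * d)) (𝟙-yes (𝟎 {n} ≟ᵥ 𝟎) refl) ⟩
    A * (A * + 1)                      ≡⟨ cong (A *_) (*-identityʳ A) ⟩
    A * A                              ∎
    where
    open ≡-Reasoning
    derivative-𝟎 : ∀ x → derivative 𝟎 x ≡ 𝟎
    derivative-𝟎 x = trans (cong (λ y → F x ⊕ F y) (⊕-identityʳ x)) (⊕-self (F x))

  module _ (apn : APN F) {u : 𝔽₂^ n} (u≢𝟎 : u ≢ 𝟎) where

    fibre : 𝔽₂^ n → ℕ
    fibre x = ℕSum.∑ n (λ z → ℕSum.δ (derivative u x) (derivative u z))

    fibre≤2 : ∀ x → fibre x ≤ 2
    fibre≤2 x = subst (_≤ 2) (trans (ℕSum.length-filter-allVec n solution?) (ℕSum.∑-cong n indicators))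
                      (apn u (derivative u x) u≢𝟎)
      where
      solution? = λ z → F (z ⊕ u) ⊕ F z ≟ᵥ derivative u x
      same-fibre : ∀ {z} → (F (z ⊕ u) ⊕ F z ≡ derivative u x) ⇔ (derivative u x ≡ derivative u z)
      same-fibre = mk⇔ (λ e → trans (sym e) (⊕-comm _ _)) (λ e → trans (⊕-comm _ _) (sym e))
      indicators : ∀ z → ℕSum.𝟙 (solution? z) ≡ ℕSum.δ (derivative u x) (derivative u z)
      indicators z = ℕSum.𝟙-⇔ same-fibre (solution? z) (derivative u x ≟ᵥ derivative u z)

    2≤fibre : ∀ x → 2 ≤ fibre x
    2≤fibre x = subst (_≤ fibre x) ∑-endpoints (ℕSum.∑-mono-≤ n endpoints-in-fibre)
      where
      ∑-endpoints : ℕSum.∑ n (λ z → ℕSum.δ z x ℕ.+ ℕSum.δ z (x ⊕ u)) ≡ 2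
      ∑-endpoints = trans (ℕSum.∑-distrib-+ n _ _) (cong₂ ℕ._+_ (ℕSum.∑-δ₁ n x) (ℕSum.∑-δ₁ n (x ⊕ u)))
      x≢x⊕u : x ≢ x ⊕ u
      x≢x⊕u x≡x⊕u = u≢𝟎 (trans (sym (⊕-cancelˡ x u)) (trans (cong (x ⊕_) (sym x≡x⊕u)) (⊕-self x)))
      endpoints-in-fibre : ∀ z → ℕSum.δ z x ℕ.+ ℕSum.δ z (x ⊕ u) ≤ ℕSum.δ (derivative u x) (derivative u z)
      endpoints-in-fibre z with z ≟ᵥ x | z ≟ᵥ x ⊕ u
      ... | yes refl | yes z≡x⊕u = ⊥-elim (x≢x⊕u z≡x⊕u)
      ... | yes refl | no _ rewrite ℕSum.𝟙-yes (derivative u z ≟ᵥ derivative u z) refl = ℕP.≤-refl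
      ... | no _ | yes refl rewrite ℕSum.𝟙-yes (derivative u x ≟ᵥ derivative u (x ⊕ u)) (sym (derivative-shift x)) =
        ℕP.≤-refl
      ... | no _ | no _ = ℕ.z≤n

    collisions-apn : collisions u ≡ A * + 2
    collisions-apn = begin
      collisions u     ≡⟨ ∑-cong n (λ x → sym (∑-cong n (λ z → 𝟙-pos (derivative u x ≟ᵥ derivative u z)))) ⟩
      ∑ n (λ x → ∑ n (λ z → + ℕSum.δ (derivative u x) (derivative u z)))
                       ≡⟨ ∑-cong n (λ x → trans (∑-pos n _) (cong +_ (ℕP.≤-antisym (fibre≤2 x) (2≤fibre x)))) ⟩
      ∑ n (λ _ → + 2)  ≡⟨ ∑-const n (+ 2) ⟩
      A * + 2          ∎
      where open ≡-Reasoning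

  ∑-collisions : APN F → ∑ n collisions ≡ A * A + + (2 ^ n ∸ 1) * (A * + 2)
  ∑-collisions apn = begin
    ∑ n collisions
      ≡⟨ ∑-split-𝟎 n collisions ⟩
    collisions 𝟎 + ∑ n (λ u → 𝟙 (¬? (u ≟ᵥ 𝟎)) * collisions u)
      ≡⟨ cong₂ _+_ collisions-𝟎 (∑-cong n nonzero-collisions) ⟩
    A * A + ∑ n (λ u → 𝟙 (¬? (u ≟ᵥ 𝟎)) * (A * + 2))
      ≡⟨ cong (_+_ (A * A)) (trans (∑-*ʳ n (A * + 2) _) (cong (_* (A * + 2)) (∑-nonzero {n}))) ⟩
    A * A + + (2 ^ n ∸ 1) * (A * + 2) ∎
    where
    open ≡-Reasoning
    nonzero-collisions : ∀ u → 𝟙 (¬? (u ≟ᵥ 𝟎)) * collisions u ≡ 𝟙 (¬? (u ≟ᵥ 𝟎)) * (A * + 2)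
    nonzero-collisions u with u ≟ᵥ 𝟎
    ... | yes _ = refl
    ... | no u≢𝟎 = cong (+ 1 *_) (collisions-apn apn u≢𝟎)

  W⁴ : 𝔽₂^ n → 𝔽₂^ n → ℤ
  W⁴ b a = (walshF F b a * walshF F b a) * (walshF F b a * walshF F b a)

  ∑∑-W⁴ : APN F → ∑ n (λ b → ∑ n (W⁴ b)) ≡ A * (A * ∑ n collisions)
  ∑∑-W⁴ apn = begin
    ∑ n (λ b → ∑ n (W⁴ b))                     ≡⟨ ∑-cong n (λ b → fourth-moment (component F b)) ⟩
    ∑ n (λ b → A * ∑ n (λ u → H b u * H b u))  ≡⟨ trans (∑-*ˡ n A _) (cong (A *_) (∑-comm n n _)) ⟩
    A * ∑ n (λ u → ∑ n (λ b → H b u * H b u))  ≡⟨ cong (A *_) (∑-cong n ∑-autocorrelation²) ⟩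
    A * ∑ n (λ u → A * collisions u)           ≡⟨ cong (A *_) (∑-*ˡ n A collisions) ⟩
    A * (A * ∑ n collisions)                   ∎
    where
    open ≡-Reasoning
    H : 𝔽₂^ n → 𝔽₂^ n → ℤ
    H b = autocorrelation (component F b)

  ∑-W⁴-𝟎 : ∑ n (W⁴ 𝟎) ≡ A * (A * (A * A))
  ∑-W⁴-𝟎 = begin
    ∑ n (W⁴ 𝟎)                         ≡⟨ fourth-moment (component F 𝟎) ⟩
    A * ∑ n (λ u → H₀ u * H₀ u)        ≡⟨ cong (A *_) (∑-cong n (λ u → cong₂ _*_ (H₀≡A u) (H₀≡A u))) ⟩
    A * ∑ n (λ u → A * A)              ≡⟨ cong (A *_) (∑-const n _) ⟩
    A * (A * (A * A))                  ∎
    where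
    open ≡-Reasoning
    H₀ = autocorrelation (component F 𝟎)
    H₀≡A : ∀ u → H₀ u ≡ A
    H₀≡A u = trans (∑-cong n (λ x → cong₂ (λ p q → sgn (p xor q)) (⟨𝟎,⟩ (F x)) (⟨𝟎,⟩ (F (x ⊕ u)))))
                   (trans (∑-const n (+ 1)) (*-identityʳ A))

  ∑-nonzero-W⁴ : APN F → ∑ n (λ b → 𝟙 (¬? (b ≟ᵥ 𝟎)) * ∑ n (W⁴ b)) ≡ A * (A * A) * + (2 ℕ.* (2 ^ n ∸ 1))
  ∑-nonzero-W⁴ apn = begin
    ∑ n (λ b → 𝟙 (¬? (b ≟ᵥ 𝟎)) * ∑ n (W⁴ b))
      ≡⟨ trans (peel (∑ n (W⁴ 𝟎)) _) (cong (_- ∑ n (W⁴ 𝟎)) (sym (∑-split-𝟎 n (λ b → ∑ n (W⁴ b))))) ⟩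
    ∑ n (λ b → ∑ n (W⁴ b)) - ∑ n (W⁴ 𝟎)
      ≡⟨ cong₂ _-_ (trans (∑∑-W⁴ apn) (cong (λ c → A * (A * c)) (∑-collisions apn))) ∑-W⁴-𝟎 ⟩
    A * (A * (A * A + M * (A * + 2))) - A * (A * (A * A))
      ≡⟨ simplify A M ⟩
    A * (A * A) * (+ 2 * M)
      ≡⟨ cong (A * (A * A) *_) (sym (pos-* 2 (2 ^ n ∸ 1))) ⟩
    A * (A * A) * + (2 ℕ.* (2 ^ n ∸ 1)) ∎
    where
    open ≡-Reasoning
    M = + (2 ^ n ∸ 1)
    peel : ∀ y z → z ≡ (y + z) - y
    peel = solve-∀
    simplify : ∀ A M → A * (A * (A * A + M * (A * + 2))) - A * (A * (A * A)) ≡ A * (A * A) * (+ 2 * M)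
    simplify = solve-∀

module Arithmetic where
  open import Data.Nat
  open import Data.Nat.Properties
  open import Data.Nat.Divisibility using (_∣_; divides)
  open import Data.Nat.Primality using (euclidsLemma; prime[2])
  open import Data.Nat.Tactic.RingSolver using (solve-∀)
  open import Data.Nat.DivMod using (m*n/n≡m)
  open import Data.Sum using (reduce)
  open import Data.Product using (Σ; _×_; _,_; proj₁; proj₂)
  open import Function.Bundles using (_⇔_; mk⇔)
  open import Relation.Binary.PropositionalEquality

  m*m≢2^[1+2q] : ∀ q m → m * m ≢ 2 ^ suc (q * 2)
  m*m≢2^[1+2q] q m m²≡
    with reduce (euclidsLemma m m prime[2] (divides (2 ^ (q * 2)) (trans m²≡ (*-comm 2 (2 ^ (q * 2))))))
  ... | divides r refl = half-square q (*-cancelˡ-≡ _ _ 2 (trans (sym (quadruple r)) m²≡))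
    where
    quadruple : ∀ r → r * 2 * (r * 2) ≡ 2 * (2 * (r * r))
    quadruple = solve-∀
    half-square : ∀ q → 2 * (r * r) ≢ 2 ^ (q * 2)
    half-square zero eq with m*n≡1⇒m≡1 2 (r * r) eq
    ... | ()
    half-square (suc q) eq = m*m≢2^[1+2q] q r (*-cancelˡ-≡ _ _ 2 eq)

  2^[2q]≡1+3t : ∀ q → Σ ℕ λ t → 2 ^ (q * 2) ≡ suc (t * 3)
  2^[2q]≡1+3t zero = 0 , refl
  2^[2q]≡1+3t (suc q) with 2^[2q]≡1+3t q
  ... | t , eq = suc (t * 4) , trans (cong (λ m → 2 * (2 * m)) eq) (quadruple t)
    where
    quadruple : ∀ t → 2 * (2 * suc (t * 3)) ≡ suc (suc (t * 4) * 3)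
    quadruple = solve-∀

  3∣2^[2q]∸1 : ∀ q → 3 ∣ 2 ^ (q * 2) ∸ 1
  3∣2^[2q]∸1 q = divides (proj₁ (2^[2q]≡1+3t q)) (cong (_∸ 1) (proj₂ (2^[2q]≡1+3t q)))

  2^[n+1]∸2≡2*[2^n∸1] : ∀ n → 2 ^ (n + 1) ∸ 2 ≡ 2 * (2 ^ n ∸ 1)
  2^[n+1]∸2≡2*[2^n∸1] n = trans (cong (λ k → 2 ^ k ∸ 2) (+-comm n 1)) (sym (*-distribˡ-∸ 2 (2 ^ n) 1))

  thirds⇔ : ∀ {I B K t} → I ≡ t * 3 → (3 * B ≡ 2 * I × B + K ≡ I) ⇔ ((2 * I) / 3 ≡ B × I / 3 ≡ K)
  thirds⇔ {B = B} {K} {t} refl = mk⇔ to from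
    where
    2I/3≡2t : (2 * (t * 3)) / 3 ≡ 2 * t
    2I/3≡2t = trans (cong (_/ 3) (sym (*-assoc 2 t 3))) (m*n/n≡m (2 * t) 3)
    to : 3 * B ≡ 2 * (t * 3) × B + K ≡ t * 3 → (2 * (t * 3)) / 3 ≡ B × (t * 3) / 3 ≡ K
    to (3B≡ , B+K≡) = trans 2I/3≡2t (sym B≡2t) , trans (m*n/n≡m t 3) (sym K≡t)
      where
      B≡2t : B ≡ 2 * t
      B≡2t = *-cancelˡ-≡ B (2 * t) 3 (trans 3B≡ (six t))
        where six : ∀ t → 2 * (t * 3) ≡ 3 * (2 * t)
              six = solve-∀
      K≡t : K ≡ t
      K≡t = +-cancelˡ-≡ (2 * t) K t (trans (cong (_+ K) (sym B≡2t)) (trans B+K≡ (three t)))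
        where three : ∀ t → t * 3 ≡ 2 * t + t
              three = solve-∀
    from : (2 * (t * 3)) / 3 ≡ B × (t * 3) / 3 ≡ K → 3 * B ≡ 2 * (t * 3) × B + K ≡ t * 3
    from (refl , refl) rewrite 2I/3≡2t | m*n/n≡m t 3 {{_}} = six t , three t
      where
      six : ∀ t → 3 * (2 * t) ≡ 2 * (t * 3)
      six = solve-∀
      three : ∀ t → 2 * t + t ≡ t * 3
      three = solve-∀

module Rational where
  open import Data.Nat as ℕ using (suc; NonZero)
  open import Data.Integer as ℤ using (+_; _*_)
  import Data.Nat.Properties as ℕP
  open import Data.Integer.Properties using (*-identityʳ; pos-*; +-injective)
  open import Data.Rational using (_≤_; _/_)
  open import Data.Rational.Properties using (fromℚᵘ-injective; fromℚᵘ-cong; toℚᵘ-cancel-≤; toℚᵘ-fromℚᵘ)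
  open import Data.Rational.Unnormalised using (mkℚᵘ; *≡*; *≤*) renaming (_≃_ to _≃ᵘ_)
  open import Data.Rational.Unnormalised.Properties using (≤-respˡ-≃; ≤-respʳ-≃; ≃-sym)
  open import Function.Bundles using (_⇔_; mk⇔; Equivalence)
  open import Relation.Binary.PropositionalEquality

  -- p / suc c is fromℚᵘ (mkℚᵘ p c) by definition.
  /≡/⇔ : ∀ p q c d → (p / suc c ≡ q / suc d) ⇔ (p * + suc d ≡ q * + suc c)
  /≡/⇔ p q c d = mk⇔ (λ eq → cross (fromℚᵘ-injective {mkℚᵘ p c} {mkℚᵘ q d} eq))
                     (λ eq → fromℚᵘ-cong {mkℚᵘ p c} {mkℚᵘ q d} (*≡* eq))
    where cross : ∀ {p q c d} → mkℚᵘ p c ≃ᵘ mkℚᵘ q d → p * + suc d ≡ q * + suc c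
          cross (*≡* eq) = eq

  /≤/ : ∀ p q c d → p * + suc d ℤ.≤ q * + suc c → p / suc c ≤ q / suc d
  /≤/ p q c d le = toℚᵘ-cancel-≤
    (≤-respʳ-≃ (≃-sym (toℚᵘ-fromℚᵘ (mkℚᵘ q d))) (≤-respˡ-≃ (≃-sym (toℚᵘ-fromℚᵘ (mkℚᵘ p c))) (*≤* le)))

  *-/-cancel : ∀ p d .{{_ : NonZero d}} → (p * + d) / d ≡ p / 1
  *-/-cancel p (suc d) = Equivalence.from (/≡/⇔ (p * + suc d) p d 0) (*-identityʳ _)

  ℕ/≡/⇔ : ∀ k m c d → (+ k / suc c ≡ + m / suc d) ⇔ (k ℕ.* suc d ≡ m ℕ.* suc c)
  ℕ/≡/⇔ k m c d = mk⇔
    (λ eq → +-injective (trans (pos-* k (suc d)) (trans (Equivalence.to ℤ-version eq) (sym (pos-* m (suc c))))))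
    (λ eq → Equivalence.from ℤ-version (trans (sym (pos-* k (suc d))) (trans (cong +_ eq) (pos-* m (suc c)))))
    where ℤ-version = /≡/⇔ (+ k) (+ m) c d

  ℕ/≤/ : ∀ k m c d → k ℕ.* suc d ℕ.≤ m ℕ.* suc c → + k / suc c ≤ + m / suc d
  ℕ/≤/ k m c d le = /≤/ (+ k) (+ m) c d (subst₂ ℤ._≤_ (pos-* k (suc d)) (pos-* m (suc c)) (ℤ.+≤+ le))

  k/1≡m/3⇔ : ∀ k m → (+ k / 1 ≡ + m / 3) ⇔ (3 ℕ.* k ≡ m)
  k/1≡m/3⇔ k m = mk⇔
    (λ eq → trans (ℕP.*-comm 3 k) (trans (Equivalence.to (ℕ/≡/⇔ k m 0 2) eq) (ℕP.*-identityʳ m)))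
    (λ eq → Equivalence.from (ℕ/≡/⇔ k m 0 2) (trans (ℕP.*-comm k 3) (trans eq (sym (ℕP.*-identityʳ m)))))

  k/1≡m/1⇔ : ∀ k m → (+ k / 1 ≡ + m / 1) ⇔ (k ≡ m)
  k/1≡m/1⇔ k m = mk⇔ (λ eq → ℕP.*-cancelʳ-≡ k m 1 (Equivalence.to (ℕ/≡/⇔ k m 0 0) eq))
                     (λ eq → Equivalence.from (ℕ/≡/⇔ k m 0 0) (cong (ℕ._* 1) eq))

  m/3≤k/1 : ∀ m k → m ℕ.≤ 3 ℕ.* k → + m / 3 ≤ + k / 1
  m/3≤k/1 m k le = ℕ/≤/ m k 2 0 (subst₂ ℕ._≤_ (sym (ℕP.*-identityʳ m)) (ℕP.*-comm 3 k) le)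

  k/1≤m/1 : ∀ k m → k ℕ.≤ m → + k / 1 ≤ + m / 1
  k/1≤m/1 k m le = ℕ/≤/ k m 0 0 (ℕP.*-monoˡ-≤ 1 le)

module Plateau {n : ℕ} (f : 𝔽₂^ n → Bool) where
  open import Data.Nat as ℕ using (_^_; _≤_)
  import Data.Nat.Properties as ℕP
  open import Data.Integer as ℤ using (+_; _+_; _-_; _*_; ∣_∣)
  open import Data.Integer.Properties
  open import Data.Integer.Tactic.RingSolver using (solve-∀)
  open import Data.List using (length; filter)
  open import Data.Product using (∃; _,_)
  open import Data.Sum using (_⊎_; inj₁; inj₂; reduce)
  open import Data.Bool.Properties using (xor-identityʳ)
  open import Function.Bundles using (_⇔_; mk⇔; Equivalence)
  open import Relation.Binary.PropositionalEquality
  open import Relation.Nullary using (¬_)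
  open Vector
  open ℤSum
  open Fourier

  i*i≡+∣i∣^2 : ∀ i → i * i ≡ + (∣ i ∣ ^ 2)
  i*i≡+∣i∣^2 (+ m) = trans (sym (pos-* m m)) (cong (λ k → + (m ℕ.* k)) (sym (ℕP.*-identityʳ m)))
  i*i≡+∣i∣^2 ℤ.-[1+ m ] = cong (λ k → + (ℕ.suc m ℕ.* k)) (sym (ℕP.*-identityʳ (ℕ.suc m)))

  2^n*2^n≢0 : + 2 ^ n * + 2 ^ n ≢ + 0
  2^n*2^n≢0 eq = ℕP.<-irrefl (sym (+-injective (reduce (i*j≡0⇒i≡0∨j≡0 (+ 2 ^ n) eq)))) (ℕP.m^n>0 2 n)

  walsh-nonvanishing : ∃ λ a → walsh f a ≢ + 0
  walsh-nonvanishing with ∑≢0⇒∃≢0 n (λ a → walsh f a * walsh f a) (λ ∑≡0 → 2^n*2^n≢0 (trans (sym (parseval f)) ∑≡0))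
  ... | a , W²≢0 = a , λ W≡0 → W²≢0 (cong (λ w → w * w) W≡0)

  plateaued-walsh² : ∀ {s} → Plateaued s f →
    ∀ a → walsh f a * walsh f a ≡ + 0 ⊎ walsh f a * walsh f a ≡ + 2 ^ (n ℕ.+ s)
  plateaued-walsh² plateaued a with plateaued a
  ... | inj₁ ∣W∣≡0 = inj₁ (cong (λ w → w * w) (∣i∣≡0⇒i≡0 {walsh f a} ∣W∣≡0))
  ... | inj₂ ∣W∣²≡ = inj₂ (trans (i*i≡+∣i∣^2 (walsh f a)) (cong +_ ∣W∣²≡))

  bent-walsh² : Bent f → ∀ a → walsh f a * walsh f a ≡ + 2 ^ n
  bent-walsh² bent a = trans (i*i≡+∣i∣^2 (walsh f a)) (cong +_ (bent a))

  bent⇒plateaued-0 : Bent f → Plateaued 0 f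
  bent⇒plateaued-0 bent a = inj₂ (trans (bent a) (cong (2 ^_) (sym (ℕP.+-identityʳ n))))

  plateaued-1-odd : ∀ q → n ≡ q ℕ.* 2 → ¬ Plateaued 1 f
  plateaued-1-odd q refl plateaued with walsh-nonvanishing
  ... | a , W≢0 with plateaued a
  ...   | inj₁ ∣W∣≡0 = W≢0 (∣i∣≡0⇒i≡0 ∣W∣≡0)
  ...   | inj₂ ∣W∣²≡ = Arithmetic.m*m≢2^[1+2q] q ∣ walsh f a ∣
          (trans (cong (∣ walsh f a ∣ ℕ.*_) (sym (ℕP.*-identityʳ _)))
                 (trans ∣W∣²≡ (cong (2 ^_) (ℕP.+-comm (q ℕ.* 2) 1))))

  plateaued-0⇒bent : Plateaued 0 f → Bent f
  plateaued-0⇒bent plateaued = ℕSum.∑-≡⇒≗ n ∣W∣²≤2^n ∑∣W∣²≡∑2^n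
    where
    ∣W∣²≤2^n : ∀ a → ∣ walsh f a ∣ ^ 2 ≤ 2 ^ n
    ∣W∣²≤2^n a with plateaued a
    ... | inj₁ ∣W∣≡0 rewrite ∣W∣≡0 = ℕ.z≤n
    ... | inj₂ ∣W∣²≡ = ℕP.≤-reflexive (trans ∣W∣²≡ (cong (2 ^_) (ℕP.+-identityʳ n)))
    ∑∣W∣²≡∑2^n : ℕSum.∑ n (λ a → ∣ walsh f a ∣ ^ 2) ≡ ℕSum.∑ n (λ _ → 2 ^ n)
    ∑∣W∣²≡∑2^n = +-injective (begin
      + ℕSum.∑ n (λ a → ∣ walsh f a ∣ ^ 2)  ≡⟨ sym (∑-pos n _) ⟩
      ∑ n (λ a → + (∣ walsh f a ∣ ^ 2))     ≡⟨ sym (∑-cong n (λ a → i*i≡+∣i∣^2 (walsh f a))) ⟩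
      ∑ n (λ a → walsh f a * walsh f a)     ≡⟨ parseval f ⟩
      + 2 ^ n * + 2 ^ n                     ≡⟨ sym (pos-* (2 ^ n) (2 ^ n)) ⟩
      + (2 ^ n ℕ.* 2 ^ n)                   ≡⟨ cong +_ (sym (ℕSum.∑-const n (2 ^ n))) ⟩
      + ℕSum.∑ n (λ _ → 2 ^ n)              ∎)
      where open ≡-Reasoning

  plateaued-suc⇒¬bent : ∀ {s} → Plateaued (ℕ.suc s) f → ¬ Bent f
  plateaued-suc⇒¬bent {s} plateaued bent with walsh-nonvanishing
  ... | a , W≢0 with plateaued a
  ...   | inj₁ ∣W∣≡0 = W≢0 (∣i∣≡0⇒i≡0 ∣W∣≡0)
  ...   | inj₂ ∣W∣²≡ = ℕP.<-irrefl (trans (sym (bent a)) ∣W∣²≡)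
                         (ℕP.^-monoʳ-< 2 (ℕ.s≤s (ℕ.s≤s ℕ.z≤n)) (ℕP.m<m+n n ℕ.z<s))

  ∑-walsh⁴ : ∀ {s} → Plateaued s f →
    ∑ n (λ a → (walsh f a * walsh f a) * (walsh f a * walsh f a)) ≡ + 2 ^ (n ℕ.+ s) * (+ 2 ^ n * + 2 ^ n)
  ∑-walsh⁴ {s} plateaued =
    trans (∑-cong n W⁴≡) (trans (∑-*ˡ n (+ 2 ^ (n ℕ.+ s)) _) (cong (+ 2 ^ (n ℕ.+ s) *_) (parseval f)))
    where
    W⁴≡ : ∀ a → (walsh f a * walsh f a) * (walsh f a * walsh f a) ≡ + 2 ^ (n ℕ.+ s) * (walsh f a * walsh f a)
    W⁴≡ a with plateaued-walsh² plateaued a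
    ... | inj₁ W²≡0 rewrite W²≡0 = sym (*-zeroʳ (+ 2 ^ (n ℕ.+ s)))
    ... | inj₂ W²≡ = cong (_* (walsh f a * walsh f a)) W²≡

  zeros : ℕ
  zeros = length (filter (λ x → f x B.≟ false) (allVec n))

  walsh-𝟎 : walsh f 𝟎 + + 2 ^ n ≡ + 2 * + zeros
  walsh-𝟎 = begin
    walsh f 𝟎 + + 2 ^ n
      ≡⟨ cong₂ _+_ (foldr-allVec n _) (sym (trans (∑-const n (+ 1)) (*-identityʳ _))) ⟩
    ∑ n (λ x → sgn (f x xor ⟨ 𝟎 , x ⟩)) + ∑ n (λ _ → + 1)
      ≡⟨ sym (∑-distrib-+ n _ _) ⟩
    ∑ n (λ x → sgn (f x xor ⟨ 𝟎 , x ⟩) + + 1)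
      ≡⟨ ∑-cong n sgn+1 ⟩
    ∑ n (λ x → + 2 * 𝟙 (f x B.≟ false))
      ≡⟨ ∑-*ˡ n (+ 2) _ ⟩
    + 2 * ∑ n (λ x → 𝟙 (f x B.≟ false))
      ≡⟨ cong (+ 2 *_) ∑𝟙≡zeros ⟩
    + 2 * + zeros ∎
    where
    open ≡-Reasoning
    ∑𝟙≡zeros : ∑ n (λ x → 𝟙 (f x B.≟ false)) ≡ + zeros
    ∑𝟙≡zeros = trans (sym (∑-cong n (λ x → 𝟙-pos (f x B.≟ false))))
                     (trans (∑-pos n _) (cong +_ (sym (ℕSum.length-filter-allVec n (λ x → f x B.≟ false)))))
    sgn+1 : ∀ x → sgn (f x xor ⟨ 𝟎 , x ⟩) + + 1 ≡ + 2 * 𝟙 (f x B.≟ false)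
    sgn+1 x rewrite ⟨𝟎,⟩ x | xor-identityʳ (f x) with f x
    ... | false = refl
    ... | true = refl

  balanced⇔walsh𝟎≡0 : ∀ {m} → n ≡ ℕ.suc m → Balanced f ⇔ walsh f 𝟎 ≡ + 0
  balanced⇔walsh𝟎≡0 {m} refl = mk⇔ to from
    where
    to : Balanced f → walsh f 𝟎 ≡ + 0
    to balanced = begin
      walsh f 𝟎                               ≡⟨ peel (walsh f 𝟎) (+ 2 ^ n) ⟩
      (walsh f 𝟎 + + 2 ^ n) - + 2 ^ n         ≡⟨ cong (_- + 2 ^ n) (trans walsh-𝟎 (sym (pos-* 2 zeros))) ⟩
      + (2 ℕ.* zeros) - + 2 ^ n               ≡⟨ cong (λ k → + (2 ℕ.* k) - + 2 ^ n) balanced ⟩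
      + 2 ^ n - + 2 ^ n                       ≡⟨ +-inverseʳ (+ 2 ^ n) ⟩
      + 0                                     ∎
      where
      open ≡-Reasoning
      peel : ∀ x c → x ≡ (x + c) - c
      peel = solve-∀
    from : walsh f 𝟎 ≡ + 0 → Balanced f
    from W≡0 = sym (ℕP.*-cancelˡ-≡ (2 ^ m) zeros 2
      (+-injective (trans (cong (_+ + 2 ^ n) (sym W≡0)) (trans walsh-𝟎 (sym (pos-* 2 zeros))))))

  bent⇒¬balanced : ∀ {m} → n ≡ ℕ.suc m → Bent f → ¬ Balanced f
  bent⇒¬balanced n≡1+m bent balanced = ℕP.<-irrefl (+-injective 0≡2^n) (ℕP.m^n>0 2 n)
    where
    0≡2^n : + 0 ≡ + 2 ^ n
    0≡2^n = trans (cong (λ w → w * w) (sym (Equivalence.to (balanced⇔walsh𝟎≡0 n≡1+m) balanced))) (bent-walsh² bent 𝟎)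

module Kinds where
  open import Data.Nat
  open import Data.Nat.Properties
  open import Data.Product using (_×_; _,_)
  open import Relation.Nullary using (contradiction)
  open import Function.Bundles using (_⇔_; mk⇔)
  open import Relation.Binary.PropositionalEquality

  -- `origin` stands for b = 0, and `balanced s`, `unbalanced s` for (2 + s)-plateaued components F_b;
  -- `level` is 2^(s_b) and `share` is W_b(0)²/2^n, the contribution of b to the imbalance.
  data Kind : Set where
    origin bent : Kind
    balanced unbalanced : ℕ → Kind

  isNonzero isBent isBalanced level share : Kind → ℕ
  isNonzero origin = 0
  isNonzero _ = 1
  isBent bent = 1
  isBent _ = 0
  isBalanced (balanced _) = 1
  isBalanced _ = 0
  level origin = 0
  level bent = 1
  level (balanced s) = 2 ^ (2 + s)
  level (unbalanced s) = 2 ^ (2 + s)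
  share bent = 1
  share (unbalanced s) = 2 ^ (2 + s)
  share _ = 0

  4≤2^[2+s] : ∀ s → 4 ≤ 2 ^ (2 + s)
  4≤2^[2+s] s = ^-monoʳ-≤ 2 (m≤m+n 2 s)

  4*nonzero≤3*share+level : ∀ k → 4 * isNonzero k ≤ 3 * share k + level k
  4*nonzero≤3*share+level origin = z≤n
  4*nonzero≤3*share+level bent = ≤-refl
  4*nonzero≤3*share+level (balanced s) = 4≤2^[2+s] s
  4*nonzero≤3*share+level (unbalanced s) = ≤-trans (4≤2^[2+s] s) (m≤n+m (2 ^ (2 + s)) (3 * 2 ^ (2 + s)))

  share≤level : ∀ k → share k ≤ level k
  share≤level origin = z≤n
  share≤level bent = ≤-refl
  share≤level (balanced s) = z≤n
  share≤level (unbalanced s) = ≤-refl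

  4*nonzero≡3*share+level⇒ : ∀ k → 4 * isNonzero k ≡ 3 * share k + level k →
    share k ≡ isBent k × isBent k + isBalanced k ≡ isNonzero k
  4*nonzero≡3*share+level⇒ origin _ = refl , refl
  4*nonzero≡3*share+level⇒ bent _ = refl , refl
  4*nonzero≡3*share+level⇒ (balanced s) _ = refl , refl
  4*nonzero≡3*share+level⇒ (unbalanced s) eq = contradiction eq (<⇒≢ (<-≤-trans (m<m+n 4 {12} z<s)
    (+-mono-≤ (*-monoʳ-≤ 3 (4≤2^[2+s] s)) (4≤2^[2+s] s))))

  bent+balanced≤nonzero : ∀ k → isBent k + isBalanced k ≤ isNonzero k
  bent+balanced≤nonzero origin = z≤n
  bent+balanced≤nonzero bent = ≤-refl
  bent+balanced≤nonzero (balanced s) = ≤-refl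
  bent+balanced≤nonzero (unbalanced s) = z≤n

  bent+balanced≡nonzero⇒ : ∀ k → isBent k + isBalanced k ≡ isNonzero k → share k ≡ isBent k
  bent+balanced≡nonzero⇒ origin _ = refl
  bent+balanced≡nonzero⇒ bent _ = refl
  bent+balanced≡nonzero⇒ (balanced s) _ = refl
  bent+balanced≡nonzero⇒ (unbalanced s) ()

  share≡level⇔ : ∀ k → share k ≡ level k ⇔ isBalanced k ≡ 0
  share≡level⇔ origin = mk⇔ (λ _ → refl) (λ _ → refl)
  share≡level⇔ bent = mk⇔ (λ _ → refl) (λ _ → refl)
  share≡level⇔ (balanced s) = mk⇔ (λ eq → contradiction eq (<⇒≢ (m^n>0 2 (2 + s)))) (λ ())
  share≡level⇔ (unbalanced s) = mk⇔ (λ _ → refl) (λ _ → refl)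

module KindSums {n : ℕ} (kind : 𝔽₂^ n → Kinds.Kind) where
  open import Data.Nat
  open import Data.Nat.Properties
  open import Data.Product using (_×_; _,_; proj₁; proj₂)
  open import Function.Bundles using (_⇔_; mk⇔; Equivalence)
  open import Relation.Binary.PropositionalEquality
  open Kinds
  open ℕSum

  Σᵏ : (Kind → ℕ) → ℕ
  Σᵏ g = ∑ n (λ b → g (kind b))

  bent+balanced≡nonzero⇔ : Σᵏ isBent + Σᵏ isBalanced ≡ Σᵏ isNonzero ⇔
    (∀ b → isBent (kind b) + isBalanced (kind b) ≡ isNonzero (kind b))
  bent+balanced≡nonzero⇔ = mk⇔
    (λ eq → ∑-≡⇒≗ n (λ b → bent+balanced≤nonzero (kind b)) (trans (∑-distrib-+ n _ _) eq))
    (λ eq → trans (sym (∑-distrib-+ n _ _)) (∑-cong n eq))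

  BentBalancedCounts : Set
  BentBalancedCounts = 3 * Σᵏ isBent ≡ 2 * Σᵏ isNonzero × Σᵏ isBent + Σᵏ isBalanced ≡ Σᵏ isNonzero

  module _ (levels : Σᵏ level ≡ 2 * Σᵏ isNonzero) where

    ∑-3*share+level : ∑ n (λ b → 3 * share (kind b) + level (kind b)) ≡ 3 * Σᵏ share + 2 * Σᵏ isNonzero
    ∑-3*share+level = trans (∑-distrib-+ n _ _) (cong₂ _+_ (∑-*ˡ n 3 _) levels)

    ∑-4*nonzero : ∑ n (λ b → 4 * isNonzero (kind b)) ≡ 2 * Σᵏ isNonzero + 2 * Σᵏ isNonzero
    ∑-4*nonzero = trans (∑-*ˡ n 4 _) (*-distribʳ-+ (Σᵏ isNonzero) 2 2)

    lower-bound : 2 * Σᵏ isNonzero ≤ 3 * Σᵏ share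
    lower-bound = +-cancelʳ-≤ (2 * Σᵏ isNonzero) (2 * Σᵏ isNonzero) (3 * Σᵏ share) (begin
      2 * Σᵏ isNonzero + 2 * Σᵏ isNonzero              ≡⟨ sym ∑-4*nonzero ⟩
      ∑ n (λ b → 4 * isNonzero (kind b))               ≤⟨ ∑-mono-≤ n (λ b → 4*nonzero≤3*share+level (kind b)) ⟩
      ∑ n (λ b → 3 * share (kind b) + level (kind b))  ≡⟨ ∑-3*share+level ⟩
      3 * Σᵏ share + 2 * Σᵏ isNonzero                  ∎)
      where open ≤-Reasoning

    upper-bound : Σᵏ share ≤ 2 * Σᵏ isNonzero
    upper-bound = subst (Σᵏ share ≤_) levels (∑-mono-≤ n (λ b → share≤level (kind b)))

    lower-bound-tight : 3 * Σᵏ share ≡ 2 * Σᵏ isNonzero ⇔ BentBalancedCounts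
    lower-bound-tight = mk⇔ to from
      where
      to : 3 * Σᵏ share ≡ 2 * Σᵏ isNonzero → BentBalancedCounts
      to eq = trans (cong (3 *_) (sym (∑-cong n (λ b → proj₁ (tight b))))) eq
            , Equivalence.from bent+balanced≡nonzero⇔ (λ b → proj₂ (tight b))
        where
        tight : ∀ b → share (kind b) ≡ isBent (kind b) × isBent (kind b) + isBalanced (kind b) ≡ isNonzero (kind b)
        tight b = 4*nonzero≡3*share+level⇒ (kind b) (∑-≡⇒≗ n (λ b → 4*nonzero≤3*share+level (kind b))
          (trans ∑-4*nonzero (trans (cong (_+ 2 * Σᵏ isNonzero) (sym eq)) (sym ∑-3*share+level))) b)
      from : BentBalancedCounts → 3 * Σᵏ share ≡ 2 * Σᵏ isNonzero
      from (3*bents≡ , bents+balanceds≡) = trans (cong (3 *_) (∑-cong n (λ b →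
        bent+balanced≡nonzero⇒ (kind b) (Equivalence.to bent+balanced≡nonzero⇔ bents+balanceds≡ b)))) 3*bents≡

    upper-bound-tight : Σᵏ share ≡ 2 * Σᵏ isNonzero ⇔ (∀ b → isBalanced (kind b) ≡ 0)
    upper-bound-tight = mk⇔
      (λ eq b → Equivalence.to (share≡level⇔ (kind b))
                  (∑-≡⇒≗ n (λ b → share≤level (kind b)) (trans eq (sym levels)) b))
      (λ none → trans (∑-cong n (λ b → Equivalence.from (share≡level⇔ (kind b)) (none b))) levels)

module Components {n : ℕ} (F : 𝔽₂^ n → 𝔽₂^ n) (plateaued : PlateauedFn F) (q : ℕ) (n≡q*2 : n ≡ q ℕ.* 2)
  where
  open import Data.Nat as ℕ using (_^_; _∸_)
  import Data.Nat.Properties as ℕP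
  open import Data.Integer as ℤ using (+_; _*_)
  import Data.Integer.Properties as ℤP
  open import Data.Integer.Tactic.RingSolver using (solve-∀)
  open import Data.Empty using (⊥-elim)
  import Data.List
  import Data.Rational
  open import Data.Product using (Σ; _×_; _,_; proj₁; proj₂)
  open import Data.Sum using (inj₁; inj₂; reduce)
  open import Function.Bundles using (_⇔_; mk⇔; Equivalence)
  open import Relation.Binary.PropositionalEquality
  open import Relation.Nullary using (Dec; yes; no; ¬_; ¬?)
  open Vector
  open Kinds
  open ℤSum
  open APNMoment F using (A; W⁴; ∑-nonzero-W⁴)

  data KindOf (b : 𝔽₂^ n) : Kind → Set where
    zero-vector : b ≡ 𝟎 → KindOf b origin
    bent-component : b ≢ 𝟎 → Bent (component F b) → KindOf b bent
    balanced-component : ∀ {s} → b ≢ 𝟎 → Plateaued (2 ℕ.+ s) (component F b) → Balanced (component F b) →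
      KindOf b (balanced s)
    unbalanced-component : ∀ {s} → b ≢ 𝟎 → Plateaued (2 ℕ.+ s) (component F b) → ¬ Balanced (component F b) →
      KindOf b (unbalanced s)

  classify : ∀ b → Σ Kind (KindOf b)
  classify b with b ≟ᵥ 𝟎
  ... | yes b≡𝟎 = origin , zero-vector b≡𝟎
  ... | no b≢𝟎 with plateaued b b≢𝟎
  ...   | 0 , pl = bent , bent-component b≢𝟎 (Plateau.plateaued-0⇒bent (component F b) pl)
  ...   | 1 , pl = ⊥-elim (Plateau.plateaued-1-odd (component F b) q n≡q*2 pl)
  ...   | ℕ.suc (ℕ.suc s) , pl with Plateau.zeros (component F b) ℕ.≟ 2 ^ (n ∸ 1)
  ...     | yes bal = balanced s , balanced-component b≢𝟎 pl bal
  ...     | no ¬bal = unbalanced s , unbalanced-component b≢𝟎 pl ¬bal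

  kind : 𝔽₂^ n → Kind
  kind b = proj₁ (classify b)

  kindOf : ∀ b → KindOf b (kind b)
  kindOf b = proj₂ (classify b)

  plateaued-∑W⁴ : ∀ {s b} → Plateaued s (component F b) → ∑ n (W⁴ b) ≡ A * (A * A) * + 2 ^ s
  plateaued-∑W⁴ {s} {b} pl = begin
    ∑ n (W⁴ b)                    ≡⟨ Plateau.∑-walsh⁴ (component F b) pl ⟩
    + 2 ^ (n ℕ.+ s) * (A * A)     ≡⟨ cong (λ m → + m * (A * A)) (ℕP.^-distribˡ-+-* 2 n s) ⟩
    + (2 ^ n ℕ.* 2 ^ s) * (A * A) ≡⟨ cong (_* (A * A)) (ℤP.pos-* (2 ^ n) (2 ^ s)) ⟩
    A * + 2 ^ s * (A * A)         ≡⟨ regroup A (+ 2 ^ s) ⟩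
    A * (A * A) * + 2 ^ s         ∎
    where
    open ≡-Reasoning
    regroup : ∀ A L → A * L * (A * A) ≡ A * (A * A) * L
    regroup = solve-∀

  walsh𝟎²-unbalanced : ∀ {s b} → Plateaued (2 ℕ.+ s) (component F b) → walshF F b 𝟎 ≢ + 0 →
    walshF F b 𝟎 * walshF F b 𝟎 ≡ + 2 ^ (2 ℕ.+ s) * A
  walsh𝟎²-unbalanced {s} {b} pl W≢0 with Plateau.plateaued-walsh² (component F b) pl 𝟎
  ... | inj₁ W²≡0 = ⊥-elim (W≢0 (reduce (ℤP.i*j≡0⇒i≡0∨j≡0 (walshF F b 𝟎) W²≡0)))
  ... | inj₂ W²≡ = trans W²≡ (trans (cong +_ (trans (ℕP.^-distribˡ-+-* 2 n (2 ℕ.+ s)) (ℕP.*-comm (2 ^ n) _)))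
                                      (ℤP.pos-* (2 ^ (2 ℕ.+ s)) (2 ^ n)))

  balanced⇔walsh𝟎≡0 : ∀ {b} → b ≢ 𝟎 → Balanced (component F b) ⇔ walshF F b 𝟎 ≡ + 0
  balanced⇔walsh𝟎≡0 {b} b≢𝟎 = Plateau.balanced⇔walsh𝟎≡0 (component F b) (proj₂ (nonzero⇒dim≡suc b≢𝟎))

  bent⇒¬balanced : ∀ {b} → b ≢ 𝟎 → Bent (component F b) → ¬ Balanced (component F b)
  bent⇒¬balanced {b} b≢𝟎 = Plateau.bent⇒¬balanced (component F b) (proj₂ (nonzero⇒dim≡suc b≢𝟎))

  module _ {b : 𝔽₂^ n} where

    nonzero-spec : ∀ {k} → KindOf b k → ℕSum.𝟙 (¬? (b ≟ᵥ 𝟎)) ≡ isNonzero k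
    nonzero-spec (zero-vector b≡𝟎) = ℕSum.𝟙-no (¬? (b ≟ᵥ 𝟎)) (λ b≢𝟎 → b≢𝟎 b≡𝟎)
    nonzero-spec (bent-component b≢𝟎 _) = ℕSum.𝟙-yes (¬? (b ≟ᵥ 𝟎)) b≢𝟎
    nonzero-spec (balanced-component b≢𝟎 _ _) = ℕSum.𝟙-yes (¬? (b ≟ᵥ 𝟎)) b≢𝟎
    nonzero-spec (unbalanced-component b≢𝟎 _ _) = ℕSum.𝟙-yes (¬? (b ≟ᵥ 𝟎)) b≢𝟎

    restrict-nonzero : ∀ {k} → KindOf b k → ∀ z → 𝟙 (¬? (b ≟ᵥ 𝟎)) * z ≡ + isNonzero k * z
    restrict-nonzero v z = cong (_* z) (trans (sym (𝟙-pos (¬? (b ≟ᵥ 𝟎)))) (cong +_ (nonzero-spec v)))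

    level-spec : ∀ {k} → KindOf b k → 𝟙 (¬? (b ≟ᵥ 𝟎)) * ∑ n (W⁴ b) ≡ A * (A * A) * + level k
    level-spec v = trans (restrict-nonzero v (∑ n (W⁴ b))) (spec v)
      where
      spec : ∀ {k} → KindOf b k → + isNonzero k * ∑ n (W⁴ b) ≡ A * (A * A) * + level k
      spec (zero-vector _) = sym (ℤP.*-zeroʳ (A * (A * A)))
      spec (bent-component _ bent-f) =
        trans (ℤP.*-identityˡ _) (plateaued-∑W⁴ {b = b} (Plateau.bent⇒plateaued-0 (component F b) bent-f))
      spec (balanced-component _ pl _) = trans (ℤP.*-identityˡ _) (plateaued-∑W⁴ {b = b} pl)
      spec (unbalanced-component _ pl _) = trans (ℤP.*-identityˡ _) (plateaued-∑W⁴ {b = b} pl)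

    share-spec : ∀ {k} → KindOf b k → 𝟙 (¬? (b ≟ᵥ 𝟎)) * (walshF F b 𝟎 * walshF F b 𝟎) ≡ + share k * A
    share-spec v = trans (restrict-nonzero v (walshF F b 𝟎 * walshF F b 𝟎)) (spec v)
      where
      spec : ∀ {k} → KindOf b k → + isNonzero k * (walshF F b 𝟎 * walshF F b 𝟎) ≡ + share k * A
      spec (zero-vector _) = refl
      spec (bent-component _ bent-f) =
        trans (ℤP.*-identityˡ _) (trans (Plateau.bent-walsh² (component F b) bent-f 𝟎) (sym (ℤP.*-identityˡ A)))
      spec (balanced-component b≢𝟎 _ bal) rewrite Equivalence.to (balanced⇔walsh𝟎≡0 b≢𝟎) bal = refl
      spec (unbalanced-component b≢𝟎 pl ¬bal) =
        trans (ℤP.*-identityˡ _)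
              (walsh𝟎²-unbalanced {b = b} pl (λ W≡0 → ¬bal (Equivalence.from (balanced⇔walsh𝟎≡0 b≢𝟎) W≡0)))

    bent? : ∀ {k} → KindOf b k → Dec (b ≢ 𝟎 × Bent (component F b))
    bent? (zero-vector b≡𝟎) = no λ (b≢𝟎 , _) → b≢𝟎 b≡𝟎
    bent? (bent-component b≢𝟎 bent-f) = yes (b≢𝟎 , bent-f)
    bent? (balanced-component _ pl _) = no λ (_ , bent-f) → Plateau.plateaued-suc⇒¬bent (component F b) pl bent-f
    bent? (unbalanced-component _ pl _) = no λ (_ , bent-f) → Plateau.plateaued-suc⇒¬bent (component F b) pl bent-f

    balanced? : ∀ {k} → KindOf b k → Dec (b ≢ 𝟎 × Balanced (component F b))
    balanced? (zero-vector b≡𝟎) = no λ (b≢𝟎 , _) → b≢𝟎 b≡𝟎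
    balanced? (bent-component b≢𝟎 bent-f) = no λ (_ , bal) → bent⇒¬balanced b≢𝟎 bent-f bal
    balanced? (balanced-component b≢𝟎 _ bal) = yes (b≢𝟎 , bal)
    balanced? (unbalanced-component _ _ ¬bal) = no λ (_ , bal) → ¬bal bal

    𝟙-bent? : ∀ {k} (v : KindOf b k) → ℕSum.𝟙 (bent? v) ≡ isBent k
    𝟙-bent? (zero-vector _) = refl
    𝟙-bent? (bent-component _ _) = refl
    𝟙-bent? (balanced-component _ _ _) = refl
    𝟙-bent? (unbalanced-component _ _ _) = refl

    𝟙-balanced? : ∀ {k} (v : KindOf b k) → ℕSum.𝟙 (balanced? v) ≡ isBalanced k
    𝟙-balanced? (zero-vector _) = refl
    𝟙-balanced? (bent-component _ _) = refl
    𝟙-balanced? (balanced-component _ _ _) = refl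
    𝟙-balanced? (unbalanced-component _ _ _) = refl

    unbalanced⇔ : ∀ {k} → KindOf b k → (b ≢ 𝟎 → ¬ Balanced (component F b)) ⇔ isBalanced k ≡ 0
    unbalanced⇔ (zero-vector b≡𝟎) = mk⇔ (λ _ → refl) (λ _ b≢𝟎 → ⊥-elim (b≢𝟎 b≡𝟎))
    unbalanced⇔ (bent-component b≢𝟎 bent-f) = mk⇔ (λ _ → refl) (λ _ _ → bent⇒¬balanced b≢𝟎 bent-f)
    unbalanced⇔ (balanced-component b≢𝟎 _ bal) = mk⇔ (λ ¬bal → ⊥-elim (¬bal b≢𝟎 bal)) (λ ())
    unbalanced⇔ (unbalanced-component _ _ ¬bal) = mk⇔ (λ _ → refl) (λ _ _ → ¬bal)

  open KindSums kind public

  nonzeros : Σᵏ isNonzero ≡ 2 ^ n ∸ 1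
  nonzeros = trans (sym (ℕSum.∑-cong n (λ b → nonzero-spec (kindOf b)))) (ℕSum.∑-nonzero n)

  levels : APN F → Σᵏ level ≡ 2 ℕ.* Σᵏ isNonzero
  levels apn = trans (ℤP.+-injective (ℤP.*-cancelˡ-≡ (A * (A * A)) _ _ {{A³≢0}} (begin
    A * (A * A) * + Σᵏ level               ≡⟨ cong (A * (A * A) *_) (sym (∑-pos n _)) ⟩
    A * (A * A) * ∑ n (λ b → + level (kind b))
                                           ≡⟨ sym (∑-*ˡ n (A * (A * A)) _) ⟩
    ∑ n (λ b → A * (A * A) * + level (kind b))
                                           ≡⟨ sym (∑-cong n (λ b → level-spec (kindOf b))) ⟩
    ∑ n (λ b → 𝟙 (¬? (b ≟ᵥ 𝟎)) * ∑ n (W⁴ b)) ≡⟨ ∑-nonzero-W⁴ apn ⟩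
    A * (A * A) * + (2 ℕ.* (2 ^ n ∸ 1))    ∎)))
    (cong (2 ℕ.*_) (sym nonzeros))
    where
    open ≡-Reasoning
    A≢0 : ℤ.NonZero A
    A≢0 = ℕP.m^n≢0 2 n
    A³≢0 : ℤ.NonZero (A * (A * A))
    A³≢0 = ℤP.i*j≢0 A (A * A) {{A≢0}} {{ℤP.i*j≢0 A A {{A≢0}} {{A≢0}}}}

  imbalanceSum≡ : imbalanceSum F ≡ + Σᵏ share * A
  imbalanceSum≡ = begin
    imbalanceSum F
      ≡⟨ foldr-filter (λ b → ¬? (b ≟ᵥ 𝟎)) (λ b → walshF F b 𝟎 * walshF F b 𝟎) (allVec n) ⟩
    Data.List.foldr ℤ._+_ (+ 0) (Data.List.map (λ b → 𝟙 (¬? (b ≟ᵥ 𝟎)) * (walshF F b 𝟎 * walshF F b 𝟎)) (allVec n))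
      ≡⟨ foldr-allVec n _ ⟩
    ∑ n (λ b → 𝟙 (¬? (b ≟ᵥ 𝟎)) * (walshF F b 𝟎 * walshF F b 𝟎))
      ≡⟨ ∑-cong n (λ b → share-spec (kindOf b)) ⟩
    ∑ n (λ b → + share (kind b) * A)
      ≡⟨ trans (∑-*ʳ n A _) (cong (_* A) (∑-pos n _)) ⟩
    + Σᵏ share * A ∎
    where open ≡-Reasoning

  imbalance≡ : imbalance F ≡ + Σᵏ share Data.Rational./ 1
  imbalance≡ = trans (cong (λ p → Data.Rational._/_ p (2 ^ n) {{ℕP.m^n≢0 2 n}}) imbalanceSum≡)
                     (Rational.*-/-cancel (+ Σᵏ share) (2 ^ n) {{ℕP.m^n≢0 2 n}})

  bents : ∀ k → NumComponents F Bent k ⇔ (k ≡ Σᵏ isBent)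
  bents k = subst (λ m → NumComponents F Bent k ⇔ (k ≡ m))
                  (ℕSum.∑-cong n (λ b → 𝟙-bent? (kindOf b)))
                  (ℕSum.hasCard⇔ n (λ b → bent? (kindOf b)) k)

  balanceds : ∀ k → NumComponents F Balanced k ⇔ (k ≡ Σᵏ isBalanced)
  balanceds k = subst (λ m → NumComponents F Balanced k ⇔ (k ≡ m))
                      (ℕSum.∑-cong n (λ b → 𝟙-balanced? (kindOf b)))
                      (ℕSum.hasCard⇔ n (λ b → balanced? (kindOf b)) k)

  no-balanced⇔ : (∀ b → ¬ (b ≡ 𝟎) → ¬ Balanced (component F b)) ⇔ (∀ b → isBalanced (kind b) ≡ 0)
  no-balanced⇔ = mk⇔ (λ none b → Equivalence.to (unbalanced⇔ (kindOf b)) (none b))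
                     (λ zeros b → Equivalence.from (unbalanced⇔ (kindOf b)) (zeros b))

open import Data.Nat using (ℕ; _^_; _∸_; _*_; _/_)
open import Data.Nat.Divisibility using (_∣_; divides)
open import Data.Integer using (+_)
open import Data.Rational using (_≤_) renaming (_/_ to _/ℚ_)
open import Data.Product using (_×_; _,_)
open import Function.Bundles using (_⇔_)
open import Function.Properties.Equivalence using () renaming (trans to _∘⇔_; sym to ⇔-sym)
open import Data.Product.Function.NonDependent.Propositional using (_×-⇔_)
open import Relation.Nullary using (¬_)
import Relation.Binary.PropositionalEquality as Eq

proposition6p3 : (n : ℕ) → 2 ∣ n → (F : 𝔽₂^ n → 𝔽₂^ n) → PlateauedFn F → APN F →
    ((+ (2 ^ (n Data.Nat.+ 1) ∸ 2) /ℚ 3) ≤ imbalance F)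
    × (imbalance F ≤ (+ (2 ^ (n Data.Nat.+ 1) ∸ 2) /ℚ 1))
    × ((imbalance F ≡ (+ (2 ^ (n Data.Nat.+ 1) ∸ 2) /ℚ 3))
        ⇔ (NumComponents F Bent ((2 * (2 ^ n ∸ 1)) / 3)
           × NumComponents F Balanced ((2 ^ n ∸ 1) / 3)))
    × ((imbalance F ≡ (+ (2 ^ (n Data.Nat.+ 1) ∸ 2) /ℚ 1))
        ⇔ (∀ b → ¬ (b ≡ 𝟎) → ¬ Balanced (component F b)))
proposition6p3 n (divides q n≡q*2) F plateaued apn
  rewrite Components.imbalance≡ F plateaued q n≡q*2 | Arithmetic.2^[n+1]∸2≡2*[2^n∸1] n
        | Eq.sym (Components.nonzeros F plateaued q n≡q*2) =
    Rational.m/3≤k/1 (2 * I) N (lower-bound level-sum)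
  , Rational.k/1≤m/1 N (2 * I) (upper-bound level-sum)
  , Rational.k/1≡m/3⇔ N (2 * I)
      ∘⇔ (lower-bound-tight level-sum ∘⇔ (Arithmetic.thirds⇔ {t = t} I≡t*3 ∘⇔ ⇔-sym (bents _ ×-⇔ balanceds _)))
  , Rational.k/1≡m/1⇔ N (2 * I) ∘⇔ (upper-bound-tight level-sum ∘⇔ ⇔-sym no-balanced⇔)
  where
  open Components F plateaued q n≡q*2
  open Kinds
  I N : ℕ
  I = Σᵏ isNonzero
  N = Σᵏ share
  level-sum : Σᵏ level ≡ 2 * I
  level-sum = levels apn
  open _∣_ (Arithmetic.3∣2^[2q]∸1 q) renaming (quotient to t)
  I≡t*3 : I ≡ t * 3
  I≡t*3 = Eq.trans nonzeros (Eq.trans (Eq.cong (λ m → 2 ^ m ∸ 1) n≡q*2) equality)
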